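{- Let $M$ be a matroid of rank $r$ on $E=[n]$ with rank function $\rank$, and let $\mathrm{ch}_k(M):=\iota^*(c_k(S_M))\in A^k(M)$ (the element Poincaré dual to the CSM cycle $\mathrm{csm}_{r-1-k}(M)$). Then $$\mathrm{ch}_k(M)=\sum \alpha_S(F_1,\dots,F_t,p_1,\dots,p_t)\,x_{F_1}^{p_1}x_{F_2}^{p_2}\cdots x_{F_t}^{p_t},$$ where the sum runs over all chains of flats $\emptyset\subsetneq F_1\subsetneq\cdots\subsetneq F_t\subseteq E$ of $M$ and all positive integers $p_1,\dots,p_t$ with $\sum_i p_i=k$, and $$\alpha_S(F_1,\dots,F_t,p_1,\dots,p_t)=(-1)^k\binom{\rank(F_1)}{p_1}\binom{\rank(F_2)-\tilde p_1}{p_2}\cdots\binom{\rank(F_t)-\tilde p_{t-1}}{p_t},\qquad \tilde p_i=\sum_{j=1}^ip_j.$$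
   Context: $A^*(U_{n,n})=\mathbb{Z}[x_S:\emptyset\subsetneq S\subseteq[n]]/(\langle x_Sx_T: S,T \text{ incomparable}\rangle+\langle\sum_{S\ni e}x_S:e\in[n]\rangle)$ is the Chow ring of the permutohedral toric variety. The Chow ring of $M$ is $A^*(M)=\mathbb{Z}[x_F: F \text{ nonempty flat of } M]/(\langle x_Fx_{F'}: F,F' \text{ incomparable}\rangle+\langle\sum_{F\ni e}x_F: e\in E\rangle)$, and $\iota^*:A^*(U_{n,n})\to A^*(M)$ is the surjective ring map sending $x_S\mapsto x_S$ if $S$ is a flat of $M$ and $x_S\mapsto 0$ otherwise. $c_k(S_M)\in A^k(U_{n,n})$ is the $k$-th Chern class of the tautological subbundle $K$-class of $M$ (Berget–Eur–Spink–Tseng); it is known that for any sequence of matroids $M_0,\dots,M_n$ on $[n]$ with $M_i$ of rank $i$, $M_r=M$, $M_i$ a matroid quotient of $M_j$ for $i<j$, one has $\sum_{k=0}^r c_k(S_M)t^k=\prod_{i=0}^{r-1}(1-t\sum_{\emptyset\ne S\subseteq E}(\rank_{M_{i+1}}(S)-\rank_{M_i}(S))x_S)$. -}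

module Defs where

open import Data.Nat as ℕ using (ℕ; zero; suc; _<_; _≤_; _∸_)
open import Data.Nat.Combinatorics using (_C_)
open import Data.Integer as ℤ using (ℤ; +_; -_)
open import Data.Fin using (Fin)
open import Data.Fin.Properties using (all?)
open import Data.Fin.Subset as Sub
  using (Subset; _∈_; _∉_; _⊆_; _⊂_; _∪_; _∩_; ⁅_⁆; ∣_∣; inside; outside)
  renaming (⊥ to ∅; ⊤ to Full)
open import Data.Fin.Subset.Properties using (_∈?_; _⊆?_; _⊂?_)
open import Data.Vec using ([]; _∷_)
open import Data.List using (List; []; _∷_; map; concatMap; foldr; filter; upTo; applyUpTo)
open import Data.Product using (Σ; _×_; _,_; proj₁)
open import Data.Bool using (Bool; T; true; false)
open import Data.Unit using (tt)
open import Relation.Nullary using (¬_; Dec; yes; no; ⌊_⌋)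
open import Relation.Nullary.Decidable using (_→-dec_; ¬?; _×-dec_)
open import Data.Nat.Properties using (_<?_)

record Matroid (n : ℕ) : Set where
  field
    rk         : Subset n → ℕ
    rk-bound   : ∀ X → rk X ≤ ∣ X ∣
    rk-mono    : ∀ X Y → X ⊆ Y → rk X ≤ rk Y
    rk-submod  : ∀ X Y → rk (X ∪ Y) ℕ.+ rk (X ∩ Y) ≤ rk X ℕ.+ rk Y
open Matroid public

rank : ∀ {n} → Matroid n → ℕ
rank M = rk M Full

IsFlat : ∀ {n} → Matroid n → Subset n → Set
IsFlat M F = ∀ e → e ∉ F → rk M F < rk M (F ∪ ⁅ e ⁆)

isFlat? : ∀ {n} (M : Matroid n) (F : Subset n) → Dec (IsFlat M F)
isFlat? M F = all? (λ e → ¬? (e ∈? F) →-dec (rk M F <? rk M (F ∪ ⁅ e ⁆)))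

dec⊂ : ∀ {n} (A B : Subset n) → Dec (A ⊂ B)
dec⊂ A B = A ⊂? B

IsNEFlat : ∀ {n} → Matroid n → Subset n → Set
IsNEFlat M F = (∅ ⊂ F) × IsFlat M F

isNEFlat? : ∀ {n} (M : Matroid n) (F : Subset n) → Dec (IsNEFlat M F)
isNEFlat? M F = dec⊂ ∅ F ×-dec isFlat? M F

IsQuotient : ∀ {n} → Matroid n → Matroid n → Set
IsQuotient Q M = ∀ F → IsFlat Q F → IsFlat M F

Incomparable : ∀ {n} → Subset n → Subset n → Set
Incomparable S T = ¬ (S ⊆ T) × ¬ (T ⊆ S)

allSubsets : (n : ℕ) → List (Subset n)
allSubsets zero    = [] ∷ []
allSubsets (suc n) = map (inside ∷_) (allSubsets n) Data.List.++ map (outside ∷_) (allSubsets n)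

nonemptyFlats : ∀ {n} → Matroid n → List (Subset n)
nonemptyFlats {n} M = filter (isNEFlat? M) (allSubsets n)

-- Polynomial expressions with integer coefficients in variables V, and
-- the congruence "equal in the quotient ring ℤ[V] / ⟨G⟩" for a set G of
-- generators of an ideal: the smallest congruence containing the
-- commutative-ring axioms (with ℤ-constants) and g ≈ 0 for g ∈ G.

infixl 6 _⊕_
infixl 7 _⊗_
data Poly (V : Set) : Set where
  var  : V → Poly V
  con  : ℤ → Poly V
  _⊕_  : Poly V → Poly V → Poly V
  _⊗_  : Poly V → Poly V → Poly V
  ⊝_   : Poly V → Poly V

data Eqv {V : Set} (G : Poly V → Set) : Poly V → Poly V → Set where
  refl′   : ∀ {p} → Eqv G p p
  sym′    : ∀ {p q} → Eqv G p q → Eqv G q p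
  trans′  : ∀ {p q r} → Eqv G p q → Eqv G q r → Eqv G p r
  ⊕-cong  : ∀ {p p′ q q′} → Eqv G p p′ → Eqv G q q′ → Eqv G (p ⊕ q) (p′ ⊕ q′)
  ⊗-cong  : ∀ {p p′ q q′} → Eqv G p p′ → Eqv G q q′ → Eqv G (p ⊗ q) (p′ ⊗ q′)
  ⊝-cong  : ∀ {p p′} → Eqv G p p′ → Eqv G (⊝ p) (⊝ p′)
  ⊕-assoc : ∀ p q r → Eqv G ((p ⊕ q) ⊕ r) (p ⊕ (q ⊕ r))
  ⊕-comm  : ∀ p q → Eqv G (p ⊕ q) (q ⊕ p)
  ⊕-idˡ   : ∀ p → Eqv G (con (+ 0) ⊕ p) p
  ⊝-invˡ  : ∀ p → Eqv G ((⊝ p) ⊕ p) (con (+ 0))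
  ⊗-assoc : ∀ p q r → Eqv G ((p ⊗ q) ⊗ r) (p ⊗ (q ⊗ r))
  ⊗-comm  : ∀ p q → Eqv G (p ⊗ q) (q ⊗ p)
  ⊗-idˡ   : ∀ p → Eqv G (con (+ 1) ⊗ p) p
  distribˡ : ∀ p q r → Eqv G (p ⊗ (q ⊕ r)) ((p ⊗ q) ⊕ (p ⊗ r))
  con-+   : ∀ a b → Eqv G (con a ⊕ con b) (con (a ℤ.+ b))
  con-*   : ∀ a b → Eqv G (con a ⊗ con b) (con (a ℤ.* b))
  gen     : ∀ {g} → G g → Eqv G g (con (+ 0))

Σ⊕ : ∀ {V} → List (Poly V) → Poly V
Σ⊕ = foldr _⊕_ (con (+ 0))

_^^_ : ∀ {V} → Poly V → ℕ → Poly V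
p ^^ zero  = con (+ 1)
p ^^ suc k = p ⊗ (p ^^ k)

substP : ∀ {V W} → (V → Poly W) → Poly V → Poly W
substP f (var v)  = f v
substP f (con a)  = con a
substP f (p ⊕ q)  = substP f p ⊕ substP f q
substP f (p ⊗ q)  = substP f p ⊗ substP f q
substP f (⊝ p)    = ⊝ substP f p

ifT : ∀ {A : Set} (b : Bool) → (T b → A) → A → A
ifT true  f a = f tt
ifT false f a = a


-- The ring A*(U_{n,n}) has variables x_S, ∅ ≠ S ⊆ [n].

VarU : ℕ → Set
VarU n = Σ (Subset n) (λ S → T ⌊ dec⊂ ∅ S ⌋)

xU : ∀ {n} → Subset n → Poly (VarU n)
xU S = ifT ⌊ dec⊂ ∅ S ⌋ (λ t → var (S , t)) (con (+ 0))

nonemptySubsets : (n : ℕ) → List (Subset n)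
nonemptySubsets n = filter (dec⊂ ∅) (allSubsets n)

-- The Chow ring A*(M) has variables x_F, F a nonempty flat of M.
VarM : ∀ {n} → Matroid n → Set
VarM M = Σ (Subset _) (λ F → T ⌊ isNEFlat? M F ⌋)

xM : ∀ {n} (M : Matroid n) → Subset n → Poly (VarM M)
xM M F = ifT ⌊ isNEFlat? M F ⌋ (λ t → var (F , t)) (con (+ 0))

data ChowRel {n} (M : Matroid n) : Poly (VarM M) → Set where
  incomp : (F G : VarM M) → Incomparable (proj₁ F) (proj₁ G) →
           ChowRel M (var F ⊗ var G)
  linear : (e : Fin n) →
           ChowRel M (Σ⊕ (map (xM M) (filter (e ∈?_) (nonemptyFlats M))))

-- ι* : A*(U_{n,n}) → A*(M) on representatives: x_S ↦ x_S if S is a flat, else 0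
ι* : ∀ {n} (M : Matroid n) → Poly (VarU n) → Poly (VarM M)
ι* M = substP (λ v → xM M (proj₁ v))

EqA : ∀ {n} (M : Matroid n) → Poly (VarM M) → Poly (VarM M) → Set
EqA M = Eqv (ChowRel M)

-- Chern classes via the product formula.
-- L_i = Σ_{∅ ≠ S} (rk_{i+1}(S) − rk_i(S)) x_S
Lclass : ∀ {n} → (ℕ → Matroid n) → ℕ → Poly (VarU n)
Lclass {n} Ms i =
  Σ⊕ (map (λ S → con (+ rk (Ms (suc i)) S ℤ.- + rk (Ms i) S) ⊗ xU S)
          (nonemptySubsets n))

-- coefficient of t^k in ∏_{L ∈ Ls} (1 − t L)
coeffProd : ∀ {V} → List (Poly V) → ℕ → Poly V
coeffProd []       zero    = con (+ 1)
coeffProd []       (suc k) = con (+ 0)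
coeffProd (L ∷ Ls) zero    = coeffProd Ls zero
coeffProd (L ∷ Ls) (suc k) = coeffProd Ls (suc k) ⊕ ((⊝ L) ⊗ coeffProd Ls k)

-- c_k(S_M) = coefficient of t^k in ∏_{i=0}^{r-1} (1 − t L_i), for the chain Ms, r = rank M
cS : ∀ {n} → (ℕ → Matroid n) → (r k : ℕ) → Poly (VarU n)
cS Ms r k = coeffProd (map (Lclass Ms) (upTo r)) k

chainsAbove : ∀ {n} (M : Matroid n) → ℕ → Subset n → List (List (Subset n))
chainsAbove M zero    G = [] ∷ []
chainsAbove M (suc t) G =
  concatMap (λ F → map (F ∷_) (chainsAbove M t F)) (filter (dec⊂ G) (nonemptyFlats M))

compositions : ℕ → ℕ → List (List ℕ)
compositions zero    zero    = [] ∷ []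
compositions zero    (suc k) = []
compositions (suc t) k = concatMap (λ p → map (p ∷_) (compositions t (k ∸ p))) (applyUpTo suc k)

-- ∏ᵢ binom(rank(Fᵢ) − p̃_{i−1}, pᵢ), with accumulated p̃ as third argument
binProd : ∀ {n} (M : Matroid n) → List (Subset n) → List ℕ → ℕ → ℕ
binProd M (F ∷ Fs) (p ∷ ps) pt = ((rk M F ∸ pt) C p) ℕ.* binProd M Fs ps (pt ℕ.+ p)
binProd M _        _        pt = 1

monomial : ∀ {n} (M : Matroid n) → List (Subset n) → List ℕ → Poly (VarM M)
monomial M (F ∷ Fs) (p ∷ ps) = (xM M F ^^ p) ⊗ monomial M Fs ps
monomial M _        _        = con (+ 1)

alphaS : ∀ {n} (M : Matroid n) → ℕ → List (Subset n) → List ℕ → ℤ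
alphaS M k Fs ps = ((ℤ.- + 1) ℤ.^ k) ℤ.* + binProd M Fs ps 0

chFormula : ∀ {n} (M : Matroid n) → ℕ → Poly (VarM M)
chFormula M k =
  Σ⊕ (concatMap (λ t →
        concatMap (λ Fs →
          map (λ ps → con (alphaS M k Fs ps) ⊗ monomial M Fs ps)
              (compositions t k))
          (chainsAbove M t ∅))
      (upTo (suc k)))

module Submission where

-- Let ℓᵢ = Σ_F δᵢ(F) x_F be the image of Lᵢ in A*(M), where δᵢ(F) = rk_{i+1}(F) − rk_i(F) ∈ {0,1}
-- because the Mᵢ form a chain of quotients; then ι*(c_k(S_M)) = (−1)^k e_k(ℓ_0, …, ℓ_{r−1}).
-- Take a flat H that is maximal among the flats still in play and write ℓᵢ = δᵢ(H) x_H + yᵢ. Since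
-- x_H x_F = 0 for F incomparable to H, x_H yᵢ = x_H zᵢ where zᵢ keeps only the flats below H, and
-- zᵢ = 0 whenever δᵢ(H) = 0. As exactly rk(H) of the δᵢ(H) equal 1, expanding e_k in x_H gives
--   e_k(ℓ) = e_k(y) + Σ_{j<k} C(rk H − j, k − j) x_H^{k−j} e_j(z).
-- Recursing on the flats below H turns the second sum into the chains topped by H, with exactly the
-- binomial coefficients of α_S, and recursing on the other flats gives the chains avoiding H.

open import Defs
open import Data.Nat using (ℕ; zero; suc; _≤_; _<_; z≤n; s≤s; _∸_; _+_; _*_)
open import Relation.Binary.PropositionalEquality using (_≡_)

open import Algebra.Bundles using (CommutativeRing)
import Algebra.Solver.Ring as RingSolver
open import Algebra.Solver.Ring.AlmostCommutativeRing using (fromCommutativeRing; _-Raw-AlmostCommutative⟶_)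
open import Data.Bool using (T; true; false)
open import Data.Empty using (⊥-elim)
open import Data.Fin using (Fin)
open import Data.Fin.Subset
  using (Subset; _⊆_; _⊂_; _∈_; _∉_; _∪_; _∩_; ⁅_⁆; inside; outside) renaming (⊥ to ∅; ⊤ to Full)
open import Data.Fin.Subset.Properties
  using (_∈?_; ⊂-trans; ⊂-irref; p⊂q⇒p⊆q; ⊥⊆; ⊆⊤; drop-∷-⊆; ∣⊥∣≡0; ∣⊤∣≡n; ∣⁅x⁆∣≡1;
         x∈⁅x⁆; x∈⁅y⁆⇒x≡y; p⊆p∪q; q⊆p∪q; x∈p∪q⁻; x∈p∩q⁺)
open import Data.Integer as ℤ using (ℤ; +_)
import Data.Integer.Properties as ℤ
open import Data.List
  using (List; []; _∷_; _++_; _∷ʳ_; map; filter; concatMap; applyUpTo; upTo; allFin; length)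
import Data.List.Properties as List
open import Data.List.Membership.Propositional using () renaming (_∈_ to _∈ᴸ_)
open import Data.List.Membership.Propositional.Properties using (∈-filter⁺; ∈-allFin; ∈-upTo⁻)
open import Data.List.Relation.Unary.All as All using (All; []; _∷_)
import Data.List.Relation.Unary.All.Properties as Allₚ
open import Data.List.Relation.Unary.AllPairs as AllPairs using (AllPairs; []; _∷_)
import Data.List.Relation.Unary.AllPairs.Properties as AllPairsₚ
open import Data.List.Relation.Unary.Any using (here; there)
open import Data.Maybe using (Maybe; just; nothing)
open import Data.Nat.Combinatorics using (_C_; nCk+nC[k+1]≡[n+1]C[k+1])
open import Data.Nat.ListAction using (sum)
import Data.Nat.ListAction.Properties as Sum
import Data.Nat.Properties as ℕ
open import Data.Product using (_,_; _×_; proj₁)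
open import Data.Sum using (_⊎_; inj₁; inj₂; [_,_]′)
open import Data.Unit using (tt)
import Data.Vec as Vec
open import Data.Vec using (tabulate)
import Data.Vec.Properties as Vecₚ
open import Function using (_∘_; id)
open import Level using (0ℓ)
open import Relation.Binary.Core using (Rel)
open import Relation.Binary.Definitions using (tri<; tri≈; tri>)
open import Relation.Binary.PropositionalEquality as ≡ using (refl)
open import Relation.Binary.Structures using (IsEquivalence)
open import Relation.Nullary using (Dec; yes; no; ¬_; does; ⌊_⌋)
open import Relation.Nullary.Decidable using (dec-true; fromWitness; toWitness)

private variable
  A B V : Set

suc-∸ : ∀ {j k} → j ≤ k → suc k ∸ j ≡ suc (k ∸ j)
suc-∸ = ℕ.+-∸-assoc 1

≤1⇒≡0⊎≡1 : ∀ {d} → d ≤ 1 → d ≡ 0 ⊎ d ≡ 1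
≤1⇒≡0⊎≡1 z≤n       = inj₁ refl
≤1⇒≡0⊎≡1 (s≤s z≤n) = inj₂ refl

-- Polynomial expressions modulo an ideal, and their finite sums

infix 5 ∑ ∑<

∑ : List A → (A → Poly V) → Poly V
∑ xs f = Σ⊕ (map f xs)

syntax ∑ xs (λ x → f) = ∑[ x ∈ xs ] f

∑< : ℕ → (ℕ → Poly V) → Poly V
∑< zero    f = con (+ 0)
∑< (suc T) f = ∑< T f ⊕ f T

syntax ∑< T (λ i → f) = ∑[ i < T ] f

guard : Dec A → Poly V → Poly V
guard (yes _) p = p
guard (no _)  p = con (+ 0)

𝟙 : Dec A → Poly V
𝟙 a = guard a (con (+ 1))

module QuotientRing (G : Poly V → Set) where

  infix 4 _≈_
  _≈_ : Rel (Poly V) 0ℓ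
  _≈_ = Eqv G

  0# 1# : Poly V
  0# = con (+ 0)
  1# = con (+ 1)

  ⌜_⌝ : ℕ → Poly V
  ⌜ a ⌝ = con (+ a)

  ≡⇒≈ : ∀ {p q} → p ≡ q → p ≈ q
  ≡⇒≈ refl = refl′

  commutativeRing : CommutativeRing 0ℓ 0ℓ
  commutativeRing = record
    { Carrier = Poly V ; _≈_ = _≈_ ; _+_ = _⊕_ ; _*_ = _⊗_ ; -_ = ⊝_ ; 0# = 0# ; 1# = 1#
    ; isCommutativeRing = record
      { isRing = record
        { +-isAbelianGroup = record
          { isGroup = record
            { isMonoid = record
              { isSemigroup = record
                { isMagma = record { isEquivalence = isEquivalence ; ∙-cong = ⊕-cong }
                ; assoc = ⊕-assoc }
              ; identity = ⊕-idˡ , λ p → trans′ (⊕-comm p 0#) (⊕-idˡ p) }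
            ; inverse = ⊝-invˡ , λ p → trans′ (⊕-comm p (⊝ p)) (⊝-invˡ p)
            ; ⁻¹-cong = ⊝-cong }
          ; comm = ⊕-comm }
        ; *-cong = ⊗-cong
        ; *-assoc = ⊗-assoc
        ; *-identity = ⊗-idˡ , λ p → trans′ (⊗-comm p 1#) (⊗-idˡ p)
        ; distrib = distribˡ , λ p q r → trans′ (⊗-comm (q ⊕ r) p)
                                           (trans′ (distribˡ p q r) (⊕-cong (⊗-comm p q) (⊗-comm p r))) }
      ; *-comm = ⊗-comm } }
    where
    isEquivalence : IsEquivalence _≈_
    isEquivalence = record { refl = refl′ ; sym = sym′ ; trans = trans′ }

  open CommutativeRing commutativeRing public
    using (setoid; zeroˡ; zeroʳ; distribʳ; +-identityʳ; *-identityʳ)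
  open import Algebra.Properties.Group (CommutativeRing.+-group commutativeRing) using (inverseʳ-unique)

  *-≈0ʳ : ∀ a {b} → b ≈ 0# → a ⊗ b ≈ 0#
  *-≈0ʳ a b≈0 = trans′ (⊗-cong refl′ b≈0) (zeroʳ a)

  *-≈0ˡ : ∀ {a} b → a ≈ 0# → a ⊗ b ≈ 0#
  *-≈0ˡ b a≈0 = trans′ (⊗-cong a≈0 refl′) (zeroˡ b)

  con-neg : ∀ a → con (ℤ.- a) ≈ ⊝ con a
  con-neg a = inverseʳ-unique (con a) (con (ℤ.- a))
                              (trans′ (con-+ a (ℤ.- a)) (≡⇒≈ (≡.cong con (ℤ.+-inverseʳ a))))

  private
    con-morphism : ℤ.+-*-rawRing -Raw-AlmostCommutative⟶ fromCommutativeRing commutativeRing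
    con-morphism = record
      { ⟦_⟧ = con ; +-homo = λ a b → sym′ (con-+ a b) ; *-homo = λ a b → sym′ (con-* a b)
      ; -‿homo = con-neg ; 0-homo = refl′ ; 1-homo = refl′ }

    con-≟ : ∀ a b → Maybe (con a ≈ con b)
    con-≟ a b with a ℤ.≟ b
    ... | yes refl = just refl′
    ... | no _     = nothing

  open RingSolver ℤ.+-*-rawRing (fromCommutativeRing commutativeRing) con-morphism con-≟ public
    using (solve; _:+_; _:*_; _:=_; :-_)
    renaming (con to :con)

module Sums (G : Poly V → Set) where

  open QuotientRing G
  open import Relation.Binary.Reasoning.Setoid setoid

  private
    interchange : ∀ a b c d → (a ⊕ b) ⊕ (c ⊕ d) ≈ (a ⊕ c) ⊕ (b ⊕ d)
    interchange = solve 4 (λ a b c d → (a :+ b) :+ (c :+ d) := (a :+ c) :+ (b :+ d)) refl′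

  ∑-cong : ∀ {f g : A → Poly V} xs → (∀ x → f x ≈ g x) → ∑ xs f ≈ ∑ xs g
  ∑-cong []       f≈g = refl′
  ∑-cong (x ∷ xs) f≈g = ⊕-cong (f≈g x) (∑-cong xs f≈g)

  ∑-congᴬ : ∀ {P : A → Set} {f g : A → Poly V} {xs} →
            All P xs → (∀ {x} → P x → f x ≈ g x) → ∑ xs f ≈ ∑ xs g
  ∑-congᴬ []         f≈g = refl′
  ∑-congᴬ (px ∷ pxs) f≈g = ⊕-cong (f≈g px) (∑-congᴬ pxs f≈g)

  ∑-zero : (xs : List A) → ∑[ x ∈ xs ] 0# ≈ 0#
  ∑-zero []       = refl′
  ∑-zero (x ∷ xs) = trans′ (⊕-idˡ _) (∑-zero xs)

  ∑-vanish : ∀ {f : A → Poly V} xs → (∀ x → f x ≈ 0#) → ∑ xs f ≈ 0#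
  ∑-vanish xs f≈0 = trans′ (∑-cong xs f≈0) (∑-zero xs)

  ∑-⊕ : ∀ (f g : A → Poly V) xs → ∑[ x ∈ xs ] (f x ⊕ g x) ≈ ∑ xs f ⊕ ∑ xs g
  ∑-⊕ f g []       = sym′ (⊕-idˡ _)
  ∑-⊕ f g (x ∷ xs) = trans′ (⊕-cong refl′ (∑-⊕ f g xs)) (interchange _ _ _ _)

  *-∑ : ∀ c (f : A → Poly V) xs → c ⊗ ∑ xs f ≈ ∑[ x ∈ xs ] (c ⊗ f x)
  *-∑ c f []       = zeroʳ c
  *-∑ c f (x ∷ xs) = trans′ (distribˡ _ _ _) (⊕-cong refl′ (*-∑ c f xs))

  ∑-++ : ∀ (f : A → Poly V) xs ys → ∑ (xs ++ ys) f ≈ ∑ xs f ⊕ ∑ ys f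
  ∑-++ f []       ys = sym′ (⊕-idˡ _)
  ∑-++ f (x ∷ xs) ys = trans′ (⊕-cong refl′ (∑-++ f xs ys)) (sym′ (⊕-assoc _ _ _))

  ∑-map : ∀ (f : B → Poly V) (g : A → B) xs → ∑ (map g xs) f ≡ ∑ xs (f ∘ g)
  ∑-map f g xs = ≡.cong Σ⊕ (≡.sym (List.map-∘ xs))

  ∑-concatMap : ∀ (f : B → Poly V) (g : A → List B) xs → ∑ (concatMap g xs) f ≈ ∑[ x ∈ xs ] ∑ (g x) f
  ∑-concatMap f g []       = refl′
  ∑-concatMap f g (x ∷ xs) = trans′ (∑-++ f (g x) (concatMap g xs)) (⊕-cong refl′ (∑-concatMap f g xs))

  Σ⊕-concatMap : ∀ (g : A → List (Poly V)) xs → Σ⊕ (concatMap g xs) ≈ ∑[ x ∈ xs ] Σ⊕ (g x)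
  Σ⊕-concatMap g xs = begin
    Σ⊕ (concatMap g xs)      ≡⟨ ≡.cong Σ⊕ (≡.sym (List.map-id (concatMap g xs))) ⟩
    ∑ (concatMap g xs) id    ≈⟨ ∑-concatMap id g xs ⟩
    ∑[ x ∈ xs ] ∑ (g x) id   ≡⟨ ≡.cong Σ⊕ (List.map-cong (λ x → ≡.cong Σ⊕ (List.map-id (g x))) xs) ⟩
    ∑[ x ∈ xs ] Σ⊕ (g x)     ∎

  ∑<-cong : ∀ {f g : ℕ → Poly V} T → (∀ t → t < T → f t ≈ g t) → ∑< T f ≈ ∑< T g
  ∑<-cong zero    f≈g = refl′
  ∑<-cong (suc T) f≈g = ⊕-cong (∑<-cong T (λ t t<T → f≈g t (ℕ.m<n⇒m<1+n t<T))) (f≈g T (ℕ.n<1+n T))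

  ∑<-zero : ∀ T → ∑[ t < T ] 0# ≈ 0#
  ∑<-zero zero    = refl′
  ∑<-zero (suc T) = trans′ (+-identityʳ _) (∑<-zero T)

  ∑<-vanish : ∀ {f : ℕ → Poly V} T → (∀ t → t < T → f t ≈ 0#) → ∑< T f ≈ 0#
  ∑<-vanish T f≈0 = trans′ (∑<-cong T f≈0) (∑<-zero T)

  ∑<-⊕ : ∀ f g T → ∑[ t < T ] (f t ⊕ g t) ≈ ∑< T f ⊕ ∑< T g
  ∑<-⊕ f g zero    = sym′ (⊕-idˡ _)
  ∑<-⊕ f g (suc T) = trans′ (⊕-cong (∑<-⊕ f g T) refl′) (interchange _ _ _ _)

  *-∑< : ∀ c f T → c ⊗ ∑< T f ≈ ∑[ t < T ] (c ⊗ f t)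
  *-∑< c f zero    = zeroʳ c
  *-∑< c f (suc T) = trans′ (distribˡ _ _ _) (⊕-cong (*-∑< c f T) refl′)

  ∑<-suc : ∀ f T → ∑< (suc T) f ≈ f 0 ⊕ (∑[ t < T ] f (suc t))
  ∑<-suc f zero    = trans′ (⊕-idˡ _) (sym′ (+-identityʳ _))
  ∑<-suc f (suc T) = trans′ (⊕-cong (∑<-suc f T) refl′) (⊕-assoc _ _ _)

  ∑<-swap : ∀ (f : ℕ → ℕ → Poly V) T U → ∑[ t < T ] ∑[ u < U ] f t u ≈ ∑[ u < U ] ∑[ t < T ] f t u
  ∑<-swap f zero    U = sym′ (∑<-zero U)
  ∑<-swap f (suc T) U = trans′ (⊕-cong (∑<-swap f T U) refl′) (sym′ (∑<-⊕ _ (f T) U))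

  ∑<-∑-swap : ∀ (f : ℕ → A → Poly V) T xs →
              ∑[ t < T ] ∑[ x ∈ xs ] f t x ≈ ∑[ x ∈ xs ] ∑[ t < T ] f t x
  ∑<-∑-swap f zero    xs = sym′ (∑-zero xs)
  ∑<-∑-swap f (suc T) xs = trans′ (⊕-cong (∑<-∑-swap f T xs) refl′) (sym′ (∑-⊕ _ (f T) xs))

  ∑-applyUpTo : ∀ (f : ℕ → Poly V) h T → ∑ (applyUpTo h T) f ≈ ∑[ t < T ] f (h t)
  ∑-applyUpTo f h zero    = refl′
  ∑-applyUpTo f h (suc T) = begin
    ∑ (applyUpTo h (suc T)) f              ≡⟨ ≡.cong (λ hs → ∑ hs f) (≡.sym (List.applyUpTo-∷ʳ h T)) ⟩
    ∑ (applyUpTo h T ++ h T ∷ []) f        ≈⟨ ∑-++ f (applyUpTo h T) (h T ∷ []) ⟩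
    ∑ (applyUpTo h T) f ⊕ (f (h T) ⊕ 0#)   ≈⟨ ⊕-cong (∑-applyUpTo f h T) (+-identityʳ _) ⟩
    ∑[ t < suc T ] f (h t)                 ∎

  ∑<-truncate : ∀ f U T → U ≤ T → (∀ t → U ≤ t → t < T → f t ≈ 0#) → ∑< T f ≈ ∑< U f
  ∑<-truncate f U zero    z≤n   _   = refl′
  ∑<-truncate f U (suc T) U≤1+T f≈0 with U ℕ.≟ suc T
  ... | yes refl  = refl′
  ... | no  U≢1+T = trans′ (⊕-cong (∑<-truncate f U T U≤T (λ t U≤t t<T → f≈0 t U≤t (ℕ.m<n⇒m<1+n t<T)))
                                   (f≈0 T U≤T (ℕ.n<1+n T)))
                           (+-identityʳ _)
    where
    U≤T : U ≤ T
    U≤T = ℕ.m<1+n⇒m≤n (ℕ.≤∧≢⇒< U≤1+T U≢1+T)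

  guard-yes : ∀ {P : Set} → P → (d : Dec P) → ∀ p → guard d p ≈ p
  guard-yes x (yes _) p = refl′
  guard-yes x (no ¬x) p = ⊥-elim (¬x x)

  guard-no : ∀ {P : Set} → ¬ P → (d : Dec P) → ∀ p → guard d p ≈ 0#
  guard-no ¬x (yes x) p = ⊥-elim (¬x x)
  guard-no ¬x (no _)  p = refl′

  guard-⇔ : ∀ {P Q : Set} → (P → Q) → (Q → P) → (d : Dec P) (e : Dec Q) → ∀ p → guard d p ≈ guard e p
  guard-⇔ P→Q Q→P (yes x) e p = sym′ (guard-yes (P→Q x) e p)
  guard-⇔ P→Q Q→P (no ¬x) e p = sym′ (guard-no (¬x ∘ Q→P) e p)

  guard-0# : ∀ {P : Set} (d : Dec P) → guard d 0# ≈ 0#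
  guard-0# (yes _) = refl′
  guard-0# (no _)  = refl′

  guard-cong : ∀ {P : Set} (d : Dec P) {p q} → p ≈ q → guard d p ≈ guard d q
  guard-cong (yes _) p≈q = p≈q
  guard-cong (no _)  p≈q = refl′

  guard-∑ : ∀ {P : Set} (d : Dec P) (f : A → Poly V) xs → guard d (∑ xs f) ≈ ∑[ x ∈ xs ] guard d (f x)
  guard-∑ (yes _) f xs = refl′
  guard-∑ (no _)  f xs = sym′ (∑-zero xs)

  ∑-filter : ∀ {P : A → Set} (P? : ∀ x → Dec (P x)) (f : A → Poly V) xs →
             ∑ (filter P? xs) f ≈ ∑[ x ∈ xs ] guard (P? x) (f x)
  ∑-filter P? f []       = refl′
  ∑-filter P? f (x ∷ xs) with P? x
  ... | yes _ = ⊕-cong refl′ (∑-filter P? f xs)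
  ... | no  _ = trans′ (∑-filter P? f xs) (sym′ (⊕-idˡ _))

  ∑-filter-∷ : ∀ {P : A → Set} (P? : ∀ x → Dec (P x)) (f : A → Poly V) x xs →
               ∑ (filter P? (x ∷ xs)) f ≈ ∑ (filter P? xs) f ⊕ guard (P? x) (f x)
  ∑-filter-∷ P? f x xs with P? x
  ... | yes _ = ⊕-comm _ _
  ... | no  _ = sym′ (+-identityʳ _)

  ∑-filter-∷-vanish : ∀ {P : A → Set} (P? : ∀ x → Dec (P x)) (f : A → Poly V) {x} → f x ≈ 0# →
                      ∀ xs → ∑ (filter P? (x ∷ xs)) f ≈ ∑ (filter P? xs) f
  ∑-filter-∷-vanish P? f {x} fx≈0 xs with P? x
  ... | yes _ = trans′ (⊕-cong fx≈0 refl′) (⊕-idˡ _)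
  ... | no  _ = refl′

  ∑-filter-guard : ∀ {P Q : A → Set} {C : Set} (P? : ∀ x → Dec (P x)) (Q? : ∀ x → Dec (Q x)) (C? : Dec C) →
                   (∀ {x} → P x → Q x → C) → ∀ (g : A → Poly V) xs →
                   ∑[ x ∈ filter P? xs ] guard (Q? x) (g x) ≈ guard C? (∑ (filter P? (filter Q? xs)) g)
  ∑-filter-guard {P = P} {Q} P? Q? C? PQ⇒C g xs = begin
    ∑[ x ∈ filter P? xs ] guard (Q? x) (g x)
      ≈⟨ ∑-filter P? _ xs ⟩
    ∑[ x ∈ xs ] guard (P? x) (guard (Q? x) (g x))
      ≈⟨ ∑-cong xs (λ x → nest (P? x) (Q? x) (g x)) ⟩
    ∑[ x ∈ xs ] guard C? (guard (Q? x) (guard (P? x) (g x)))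
      ≈⟨ sym′ (guard-∑ C? _ xs) ⟩
    guard C? (∑[ x ∈ xs ] guard (Q? x) (guard (P? x) (g x)))
      ≈⟨ guard-cong C? (sym′ (∑-filter Q? _ xs)) ⟩
    guard C? (∑[ x ∈ filter Q? xs ] guard (P? x) (g x))
      ≈⟨ guard-cong C? (sym′ (∑-filter P? g (filter Q? xs))) ⟩
    guard C? (∑ (filter P? (filter Q? xs)) g) ∎
    where
    nest : ∀ {x} (p : Dec (P x)) (q : Dec (Q x)) a → guard p (guard q a) ≈ guard C? (guard q (guard p a))
    nest (yes px) (yes qx) a = sym′ (guard-yes (PQ⇒C px qx) C? a)
    nest (yes _)  (no _)   a = sym′ (guard-0# C?)
    nest (no _)   (yes _)  a = sym′ (guard-0# C?)
    nest (no _)   (no _)   a = sym′ (guard-0# C?)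

  ∑<-sift : ∀ (f : ℕ → Poly V) q T → ∑[ i < T ] f i ⊗ 𝟙 (q ℕ.≟ i) ≈ guard (q ℕ.<? T) (f q)
  ∑<-sift f q zero    = refl′
  ∑<-sift f q (suc T) with ℕ.<-cmp q T
  ... | tri< q<T q≢T _ = begin
    (∑[ i < T ] f i ⊗ 𝟙 (q ℕ.≟ i)) ⊕ f T ⊗ 𝟙 (q ℕ.≟ T)
      ≈⟨ ⊕-cong (trans′ (∑<-sift f q T) (guard-yes q<T (q ℕ.<? T) _))
                (*-≈0ʳ _ (guard-no q≢T (q ℕ.≟ T) _)) ⟩
    f q ⊕ 0#                     ≈⟨ +-identityʳ _ ⟩
    f q                          ≈⟨ sym′ (guard-yes (ℕ.m<n⇒m<1+n q<T) (q ℕ.<? suc T) _) ⟩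
    guard (q ℕ.<? suc T) (f q)   ∎
  ... | tri≈ q≮T refl _ = begin
    (∑[ i < q ] f i ⊗ 𝟙 (q ℕ.≟ i)) ⊕ f q ⊗ 𝟙 (q ℕ.≟ q)
      ≈⟨ ⊕-cong (trans′ (∑<-sift f q q) (guard-no q≮T (q ℕ.<? q) _))
                (trans′ (⊗-cong refl′ (guard-yes refl (q ℕ.≟ q) _)) (*-identityʳ _)) ⟩
    0# ⊕ f q                     ≈⟨ ⊕-idˡ _ ⟩
    f q                          ≈⟨ sym′ (guard-yes (ℕ.n<1+n q) (q ℕ.<? suc q) _) ⟩
    guard (q ℕ.<? suc q) (f q)   ∎
  ... | tri> q≮T q≢T T<q = begin
    (∑[ i < T ] f i ⊗ 𝟙 (q ℕ.≟ i)) ⊕ f T ⊗ 𝟙 (q ℕ.≟ T)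
      ≈⟨ ⊕-cong (trans′ (∑<-sift f q T) (guard-no q≮T (q ℕ.<? T) _))
                (*-≈0ʳ _ (guard-no q≢T (q ℕ.≟ T) _)) ⟩
    0# ⊕ 0#                      ≈⟨ ⊕-idˡ _ ⟩
    0#                           ≈⟨ sym′ (guard-no (ℕ.<⇒≱ T<q ∘ ℕ.≤-pred) (q ℕ.<? suc T) _) ⟩
    guard (q ℕ.<? suc T) (f q)   ∎

-- Elementary symmetric polynomials

module Symmetric (G : Poly V → Set) where

  open QuotientRing G
  open Sums G
  open import Relation.Binary.Reasoning.Setoid setoid

  esym : List (Poly V) → ℕ → Poly V
  esym ls       zero    = 1#
  esym []       (suc k) = 0#
  esym (l ∷ ls) (suc k) = esym ls (suc k) ⊕ l ⊗ esym ls k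

  sign : ℕ → ℤ
  sign k = (ℤ.- + 1) ℤ.^ k

  coeffProd≈sign*esym : ∀ ls k → coeffProd ls k ≈ con (sign k) ⊗ esym ls k
  coeffProd≈sign*esym []       zero    = sym′ (⊗-idˡ _)
  coeffProd≈sign*esym (l ∷ ls) zero    = coeffProd≈sign*esym ls zero
  coeffProd≈sign*esym []       (suc k) = sym′ (zeroʳ _)
  coeffProd≈sign*esym (l ∷ ls) (suc k) = begin
    coeffProd ls (suc k) ⊕ ⊝ l ⊗ coeffProd ls k
      ≈⟨ ⊕-cong (coeffProd≈sign*esym ls (suc k)) (⊗-cong refl′ (coeffProd≈sign*esym ls k)) ⟩
    con (sign (suc k)) ⊗ esym ls (suc k) ⊕ ⊝ l ⊗ (con (sign k) ⊗ esym ls k)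
      ≈⟨ ⊕-cong (⊗-cong (sym′ (con-* _ _)) refl′) refl′ ⟩
    con (ℤ.- + 1) ⊗ con (sign k) ⊗ esym ls (suc k) ⊕ ⊝ l ⊗ (con (sign k) ⊗ esym ls k)
      ≈⟨ solve 4 (λ s e₁ l e₀ → :con (ℤ.- + 1) :* s :* e₁ :+ (:- l) :* (s :* e₀)
                              := :con (ℤ.- + 1) :* s :* (e₁ :+ l :* e₀))
               refl′ (con (sign k)) (esym ls (suc k)) l (esym ls k) ⟩
    con (ℤ.- + 1) ⊗ con (sign k) ⊗ (esym ls (suc k) ⊕ l ⊗ esym ls k)
      ≈⟨ ⊗-cong (con-* _ _) refl′ ⟩
    con (sign (suc k)) ⊗ esym (l ∷ ls) (suc k) ∎

  esym-cong : ∀ {f g : A → Poly V} xs → All (λ x → f x ≈ g x) xs →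
              ∀ k → esym (map f xs) k ≈ esym (map g xs) k
  esym-cong xs       f≈g          zero    = refl′
  esym-cong []       []           (suc k) = refl′
  esym-cong (x ∷ xs) (fx≈gx ∷ f≈g) (suc k) =
    ⊕-cong (esym-cong xs f≈g (suc k)) (⊗-cong fx≈gx (esym-cong xs f≈g k))

  esym-zeros : ∀ (xs : List A) k → esym (map (λ _ → 0#) xs) k ≈ 𝟙 (0 ℕ.≟ k)
  esym-zeros xs       zero    = refl′
  esym-zeros []       (suc k) = refl′
  esym-zeros (x ∷ xs) (suc k) = trans′ (⊕-cong (esym-zeros xs (suc k)) (zeroˡ _)) (+-identityʳ _)

  esym-zero∷ : ∀ {z} → z ≈ 0# → ∀ ws k → esym (z ∷ ws) k ≈ esym ws k
  esym-zero∷ z≈0 ws zero    = refl′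
  esym-zero∷ z≈0 ws (suc k) = trans′ (⊕-cong refl′ (*-≈0ˡ _ z≈0)) (+-identityʳ _)

  weight : Poly V → ℕ → ℕ → ℕ → Poly V
  weight x c q m = ⌜ (c ∸ q) C m ⌝ ⊗ x ^^ m

  weight-pascal : ∀ x c q m → q ≤ c →
                  weight x (suc c) q (suc m) ≈ weight x c q (suc m) ⊕ x ⊗ weight x c q m
  weight-pascal x c q m q≤c = begin
    ⌜ (suc c ∸ q) C suc m ⌝ ⊗ x ^^ suc m
      ≡⟨ ≡.cong (λ a → ⌜ a C suc m ⌝ ⊗ x ^^ suc m) (suc-∸ q≤c) ⟩
    ⌜ suc (c ∸ q) C suc m ⌝ ⊗ x ^^ suc m
      ≡⟨ ≡.cong (λ a → ⌜ a ⌝ ⊗ x ^^ suc m) (≡.sym (nCk+nC[k+1]≡[n+1]C[k+1] (c ∸ q) m)) ⟩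
    con (+ (a C m) ℤ.+ + (a C suc m)) ⊗ (x ⊗ x ^^ m)
      ≈⟨ ⊗-cong (sym′ (con-+ _ _)) refl′ ⟩
    (⌜ a C m ⌝ ⊕ ⌜ a C suc m ⌝) ⊗ (x ⊗ x ^^ m)
      ≈⟨ solve 4 (λ u v x xm → (u :+ v) :* (x :* xm) := v :* (x :* xm) :+ x :* (u :* xm))
               refl′ ⌜ a C m ⌝ ⌜ a C suc m ⌝ x (x ^^ m) ⟩
    weight x c q (suc m) ⊕ x ⊗ weight x c q m ∎
    where a = c ∸ q

  data Split (x : Poly V) (d : ℕ) (y z : Poly V) : Set where
    up   : d ≡ 1 → x ⊗ y ≈ x ⊗ z → Split x d y z
    flat : d ≡ 0 → z ≈ 0# → x ⊗ y ≈ x ⊗ z → Split x d y z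

  absorbs : ∀ {x d y z} → Split x d y z → x ⊗ y ≈ x ⊗ z
  absorbs (up   _ xy≈xz)   = xy≈xz
  absorbs (flat _ _ xy≈xz) = xy≈xz

  xSum : Poly V → ℕ → List (Poly V) → ℕ → Poly V
  xSum x c ws k = ∑[ j < k ] weight x c j (k ∸ j) ⊗ esym ws j

  module Splitting (x : Poly V) {Idx : Set} (δ : Idx → ℕ) (y z : Idx → Poly V) where

    ℓ : Idx → Poly V
    ℓ i = ⌜ δ i ⌝ ⊗ x ⊕ y i

    Σδ : List Idx → ℕ
    Σδ I = sum (map δ I)

    Splits : List Idx → Set
    Splits = All (λ i → Split x (δ i) (y i) (z i))

    pull-x : ∀ a m e → a ⊗ x ^^ suc m ⊗ e ≈ x ⊗ (a ⊗ x ^^ m ⊗ e)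
    pull-x a m e = solve 4 (λ a x xm e → a :* (x :* xm) :* e := x :* (a :* xm :* e)) refl′ a x (x ^^ m) e

    esym-vanish : ∀ I → Splits I → ∀ j → Σδ I < j → esym (map z I) j ≈ 0#
    esym-vanish I       ss                       zero    ()
    esym-vanish []      []                       (suc j) _  = refl′
    esym-vanish (i ∷ I) (up δ≡1 _ ∷ ss)          (suc j) lt =
      trans′ (⊕-cong (esym-vanish I ss (suc j) (ℕ.m<n⇒m<1+n lt′))
                     (*-≈0ʳ _ (esym-vanish I ss j lt′)))
             (+-identityʳ _)
      where
      lt′ : Σδ I < j
      lt′ = ℕ.≤-pred (≡.subst (λ d → d + Σδ I < suc j) δ≡1 lt)
    esym-vanish (i ∷ I) (flat δ≡0 z≈0 _ ∷ ss)    (suc j) lt =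
      trans′ (⊕-cong (esym-vanish I ss (suc j) (≡.subst (λ d → d + Σδ I < suc j) δ≡0 lt))
                     (*-≈0ˡ _ z≈0))
             (+-identityʳ _)

    esym-absorb : ∀ I → Splits I → ∀ j → x ⊗ esym (map y I) j ≈ x ⊗ esym (map z I) j
    esym-absorb I       ss       zero    = refl′
    esym-absorb []      ss       (suc j) = refl′
    esym-absorb (i ∷ I) (s ∷ ss) (suc j) = begin
      x ⊗ (esym ys (suc j) ⊕ y i ⊗ esym ys j)
        ≈⟨ solve 4 (λ x e₁ y e₀ → x :* (e₁ :+ y :* e₀) := x :* e₁ :+ y :* (x :* e₀)) refl′ x _ (y i) _ ⟩
      x ⊗ esym ys (suc j) ⊕ y i ⊗ (x ⊗ esym ys j)
        ≈⟨ ⊕-cong (esym-absorb I ss (suc j)) (⊗-cong refl′ (esym-absorb I ss j)) ⟩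
      x ⊗ esym zs (suc j) ⊕ y i ⊗ (x ⊗ esym zs j)
        ≈⟨ ⊕-cong refl′ (solve 3 (λ y x e → y :* (x :* e) := (x :* y) :* e) refl′ (y i) x _) ⟩
      x ⊗ esym zs (suc j) ⊕ (x ⊗ y i) ⊗ esym zs j
        ≈⟨ ⊕-cong refl′ (⊗-cong (absorbs s) refl′) ⟩
      x ⊗ esym zs (suc j) ⊕ (x ⊗ z i) ⊗ esym zs j
        ≈⟨ solve 4 (λ x e₁ z e₀ → x :* e₁ :+ (x :* z) :* e₀ := x :* (e₁ :+ z :* e₀)) refl′ x _ (z i) _ ⟩
      x ⊗ (esym zs (suc j) ⊕ z i ⊗ esym zs j) ∎
      where
      ys = map y I
      zs = map z I

    xSum-absorb : ∀ {u v} → x ⊗ u ≈ x ⊗ v → ∀ c ws k → u ⊗ xSum x c ws k ≈ v ⊗ xSum x c ws k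
    xSum-absorb {u} {v} xu≈xv c ws k = begin
      u ⊗ xSum x c ws k                                   ≈⟨ *-∑< u _ k ⟩
      ∑[ j < k ] u ⊗ (weight x c j (k ∸ j) ⊗ esym ws j) ≈⟨ ∑<-cong k term ⟩
      ∑[ j < k ] v ⊗ (weight x c j (k ∸ j) ⊗ esym ws j) ≈⟨ sym′ (*-∑< v _ k) ⟩
      v ⊗ xSum x c ws k                                   ∎
      where
      through-x : ∀ a → u ⊗ (x ⊗ a) ≈ v ⊗ (x ⊗ a)
      through-x a = trans′ (solve 3 (λ u x a → u :* (x :* a) := (x :* u) :* a) refl′ u x a)
                   (trans′ (⊗-cong xu≈xv refl′) (solve 3 (λ v x a → (x :* v) :* a := v :* (x :* a)) refl′ v x a))
      term : ∀ j → j < k → u ⊗ (weight x c j (k ∸ j) ⊗ esym ws j) ≈ v ⊗ (weight x c j (k ∸ j) ⊗ esym ws j)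
      term j j<k rewrite suc-∸ j<k =
        trans′ (⊗-cong refl′ (pull-x _ _ _)) (trans′ (through-x _) (sym′ (⊗-cong refl′ (pull-x _ _ _))))

    xSum-zero∷ : ∀ {z₀} → z₀ ≈ 0# → ∀ c ws k → xSum x c (z₀ ∷ ws) k ≈ xSum x c ws k
    xSum-zero∷ z₀≈0 c ws k = ∑<-cong k (λ j _ → ⊗-cong refl′ (esym-zero∷ z₀≈0 ws j))

    xSum-[] : ∀ k → xSum x 0 [] (suc k) ≈ 0#
    xSum-[] k = begin
      xSum x 0 [] (suc k)
        ≈⟨ ∑<-suc _ k ⟩
      weight x 0 0 (suc k) ⊗ 1# ⊕ (∑[ j < k ] weight x 0 (suc j) (k ∸ j) ⊗ 0#)
        ≈⟨ ⊕-cong (*-≈0ˡ _ (zeroˡ _)) (∑<-vanish k (λ j _ → zeroʳ _)) ⟩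
      0# ⊕ 0#
        ≈⟨ ⊕-idˡ _ ⟩
      0# ∎

    xSum-∷ : ∀ c z₀ ws k →
             xSum x (suc c) (z₀ ∷ ws) (suc k) ≈
             (∑[ j < suc k ] weight x (suc c) j (suc k ∸ j) ⊗ esym ws j) ⊕ z₀ ⊗ xSum x c ws k
    xSum-∷ c z₀ ws k = begin
      xSum x (suc c) (z₀ ∷ ws) (suc k)
        ≈⟨ ∑<-suc _ k ⟩
      W₀ ⊗ 1# ⊕ (∑[ j < k ] w j ⊗ (esym ws (suc j) ⊕ z₀ ⊗ esym ws j))
        ≈⟨ ⊕-cong refl′ (trans′ (∑<-cong k (λ j _ → distribˡ _ _ _)) (∑<-⊕ _ _ k)) ⟩
      W₀ ⊗ 1# ⊕ ((∑[ j < k ] w j ⊗ esym ws (suc j)) ⊕ (∑[ j < k ] w j ⊗ (z₀ ⊗ esym ws j)))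
        ≈⟨ sym′ (⊕-assoc _ _ _) ⟩
      (W₀ ⊗ 1# ⊕ (∑[ j < k ] w j ⊗ esym ws (suc j))) ⊕ (∑[ j < k ] w j ⊗ (z₀ ⊗ esym ws j))
        ≈⟨ ⊕-cong (sym′ (∑<-suc _ k))
                  (trans′ (∑<-cong k (λ j _ → swap-z (w j) _)) (sym′ (*-∑< z₀ _ k))) ⟩
      (∑[ j < suc k ] weight x (suc c) j (suc k ∸ j) ⊗ esym ws j) ⊕ z₀ ⊗ xSum x c ws k ∎
      where
      W₀ = weight x (suc c) 0 (suc k)
      w : ℕ → Poly V
      w j = weight x c j (k ∸ j)
      swap-z : ∀ a e → a ⊗ (z₀ ⊗ e) ≈ z₀ ⊗ (a ⊗ e)
      swap-z a e = solve 3 (λ a z e → a :* (z :* e) := z :* (a :* e)) refl′ a z₀ e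

    xSum-pascal : ∀ c ws → (∀ j → c < j → esym ws j ≈ 0#) → ∀ z₀ k →
                  xSum x (suc c) (z₀ ∷ ws) (suc k) ≈
                  (xSum x c ws (suc k) ⊕ x ⊗ (xSum x c ws k ⊕ esym ws k)) ⊕ z₀ ⊗ xSum x c ws k
    xSum-pascal c ws vanish z₀ k = begin
      xSum x (suc c) (z₀ ∷ ws) (suc k)
        ≈⟨ xSum-∷ c z₀ ws k ⟩
      (∑[ j < suc k ] weight x (suc c) j (suc k ∸ j) ⊗ esym ws j) ⊕ z₀ ⊗ xSum x c ws k
        ≈⟨ ⊕-cong (trans′ (∑<-cong (suc k) term) (∑<-⊕ _ _ (suc k))) refl′ ⟩
      (xSum x c ws (suc k) ⊕ (∑[ j < suc k ] x ⊗ (weight x c j (k ∸ j) ⊗ esym ws j))) ⊕ z₀ ⊗ xSum x c ws k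
        ≈⟨ ⊕-cong (⊕-cong refl′ (sym′ (*-∑< x _ (suc k)))) refl′ ⟩
      (xSum x c ws (suc k) ⊕ x ⊗ (xSum x c ws k ⊕ weight x c k (k ∸ k) ⊗ esym ws k)) ⊕ z₀ ⊗ xSum x c ws k
        ≈⟨ ⊕-cong (⊕-cong refl′ (⊗-cong refl′ (⊕-cong refl′ last-term))) refl′ ⟩
      (xSum x c ws (suc k) ⊕ x ⊗ (xSum x c ws k ⊕ esym ws k)) ⊕ z₀ ⊗ xSum x c ws k ∎
      where
      last-term : weight x c k (k ∸ k) ⊗ esym ws k ≈ esym ws k
      last-term = trans′ (≡⇒≈ (≡.cong (λ m → weight x c k m ⊗ esym ws k) (ℕ.n∸n≡0 k)))
                         (trans′ (⊗-cong (⊗-idˡ _) refl′) (⊗-idˡ _))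
      term : ∀ j → j < suc k → weight x (suc c) j (suc k ∸ j) ⊗ esym ws j ≈
                               weight x c j (suc k ∸ j) ⊗ esym ws j ⊕ x ⊗ (weight x c j (k ∸ j) ⊗ esym ws j)
      term j j<1+k rewrite suc-∸ (ℕ.≤-pred j<1+k) with j ℕ.≤? c
      ... | yes j≤c = trans′ (⊗-cong (weight-pascal x c j (k ∸ j) j≤c) refl′)
                        (solve 4 (λ a x b e → (a :+ x :* b) :* e := a :* e :+ x :* (b :* e)) refl′ _ x _ _)
      ... | no  j≰c = trans′ (*-≈0ʳ _ e≈0)
                             (sym′ (trans′ (⊕-cong (*-≈0ʳ _ e≈0) (*-≈0ʳ x (*-≈0ʳ _ e≈0))) (⊕-idˡ _)))
        where e≈0 = vanish j (ℕ.≰⇒> j≰c)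

    esym-split : ∀ I → Splits I → ∀ k → esym (map ℓ I) k ≈ esym (map y I) k ⊕ xSum x (Σδ I) (map z I) k
    esym-split I       ss       zero    = sym′ (+-identityʳ _)
    esym-split []      []       (suc k) = sym′ (trans′ (⊕-idˡ _) (xSum-[] k))
    esym-split (i ∷ I) (s ∷ ss) (suc k) = begin
      esym (map ℓ I) (suc k) ⊕ ℓ i ⊗ esym (map ℓ I) k
        ≈⟨ ⊕-cong (esym-split I ss (suc k)) (⊗-cong refl′ (esym-split I ss k)) ⟩
      (E₁ ⊕ X₁) ⊕ ℓ i ⊗ (E₀ ⊕ X₀)
        ≈⟨ step s ⟩
      (E₁ ⊕ y i ⊗ E₀) ⊕ xSum x (δ i + c) (z i ∷ ws) (suc k) ∎
      where
      c  = Σδ I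
      ws = map z I
      E₁  = esym (map y I) (suc k)
      E₀  = esym (map y I) k
      X₁ = xSum x c ws (suc k)
      X₀ = xSum x c ws k

      step : Split x (δ i) (y i) (z i) →
             (E₁ ⊕ X₁) ⊕ ℓ i ⊗ (E₀ ⊕ X₀) ≈ (E₁ ⊕ y i ⊗ E₀) ⊕ xSum x (δ i + c) (z i ∷ ws) (suc k)
      step (up δ≡1 xy≈xz) = begin
        (E₁ ⊕ X₁) ⊕ (⌜ δ i ⌝ ⊗ x ⊕ y i) ⊗ (E₀ ⊕ X₀)
          ≡⟨ ≡.cong (λ d → (E₁ ⊕ X₁) ⊕ (⌜ d ⌝ ⊗ x ⊕ y i) ⊗ (E₀ ⊕ X₀)) δ≡1 ⟩
        (E₁ ⊕ X₁) ⊕ (1# ⊗ x ⊕ y i) ⊗ (E₀ ⊕ X₀)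
          ≈⟨ solve 6 (λ e₁ x₁ x y e₀ x₀ → (e₁ :+ x₁) :+ (:con (+ 1) :* x :+ y) :* (e₀ :+ x₀)
                                     := (e₁ :+ y :* e₀) :+ ((x₁ :+ (x :* x₀ :+ x :* e₀)) :+ y :* x₀))
                   refl′ E₁ X₁ x (y i) E₀ X₀ ⟩
        (E₁ ⊕ y i ⊗ E₀) ⊕ ((X₁ ⊕ (x ⊗ X₀ ⊕ x ⊗ E₀)) ⊕ y i ⊗ X₀)
          ≈⟨ ⊕-cong refl′ (⊕-cong (⊕-cong refl′ (⊕-cong refl′ (esym-absorb I ss k)))
                                  (xSum-absorb xy≈xz c ws k)) ⟩
        (E₁ ⊕ y i ⊗ E₀) ⊕ ((X₁ ⊕ (x ⊗ X₀ ⊕ x ⊗ esym ws k)) ⊕ z i ⊗ X₀)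
          ≈⟨ ⊕-cong refl′ (⊕-cong (⊕-cong refl′ (sym′ (distribˡ _ _ _))) refl′) ⟩
        (E₁ ⊕ y i ⊗ E₀) ⊕ ((X₁ ⊕ x ⊗ (X₀ ⊕ esym ws k)) ⊕ z i ⊗ X₀)
          ≈⟨ ⊕-cong refl′ (sym′ (xSum-pascal c ws (esym-vanish I ss) (z i) k)) ⟩
        (E₁ ⊕ y i ⊗ E₀) ⊕ xSum x (suc c) (z i ∷ ws) (suc k)
          ≡⟨ ≡.cong (λ d → (E₁ ⊕ y i ⊗ E₀) ⊕ xSum x (d + c) (z i ∷ ws) (suc k)) (≡.sym δ≡1) ⟩
        (E₁ ⊕ y i ⊗ E₀) ⊕ xSum x (δ i + c) (z i ∷ ws) (suc k) ∎
      step (flat δ≡0 z≈0 xy≈xz) = begin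
        (E₁ ⊕ X₁) ⊕ (⌜ δ i ⌝ ⊗ x ⊕ y i) ⊗ (E₀ ⊕ X₀)
          ≡⟨ ≡.cong (λ d → (E₁ ⊕ X₁) ⊕ (⌜ d ⌝ ⊗ x ⊕ y i) ⊗ (E₀ ⊕ X₀)) δ≡0 ⟩
        (E₁ ⊕ X₁) ⊕ (0# ⊗ x ⊕ y i) ⊗ (E₀ ⊕ X₀)
          ≈⟨ solve 6 (λ e₁ x₁ x y e₀ x₀ → (e₁ :+ x₁) :+ (:con (+ 0) :* x :+ y) :* (e₀ :+ x₀)
                                     := (e₁ :+ y :* e₀) :+ (x₁ :+ y :* x₀))
                   refl′ E₁ X₁ x (y i) E₀ X₀ ⟩
        (E₁ ⊕ y i ⊗ E₀) ⊕ (X₁ ⊕ y i ⊗ X₀)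
          ≈⟨ ⊕-cong refl′ (⊕-cong refl′ (trans′ (xSum-absorb xy≈xz c ws k) (*-≈0ˡ _ z≈0))) ⟩
        (E₁ ⊕ y i ⊗ E₀) ⊕ (X₁ ⊕ 0#)
          ≈⟨ ⊕-cong refl′ (trans′ (+-identityʳ _) (sym′ (xSum-zero∷ z≈0 c ws (suc k)))) ⟩
        (E₁ ⊕ y i ⊗ E₀) ⊕ xSum x c (z i ∷ ws) (suc k)
          ≡⟨ ≡.cong (λ d → (E₁ ⊕ y i ⊗ E₀) ⊕ xSum x (d + c) (z i ∷ ws) (suc k)) (≡.sym δ≡0) ⟩
        (E₁ ⊕ y i ⊗ E₀) ⊕ xSum x (δ i + c) (z i ∷ ws) (suc k) ∎

-- Sums over chains of subsets

_⊈_ : ∀ {n} → Subset n → Subset n → Set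
A ⊈ B = ¬ (A ⊆ B)

⊆∧⊄⇒⊇ : ∀ {n} {F H : Subset n} → F ⊆ H → ¬ (F ⊂ H) → H ⊆ F
⊆∧⊄⇒⊇ {F = F} F⊆H F⊄H {x} x∈H with x ∈? F
... | yes x∈F = x∈F
... | no  x∉F = ⊥-elim (F⊄H (F⊆H , x , x∈H , x∉F))

below : ∀ {n} → Subset n → List (Subset n) → List (Subset n)
below H = filter (λ F → dec⊂ F H)

module Chains (G : Poly V → Set) {n : ℕ} (d : Subset n → ℕ) (xf : Subset n → Poly V) (R : ℕ) where

  open QuotientRing G
  open Sums G
  open Symmetric G using (weight)
  open import Relation.Binary.Reasoning.Setoid setoid

  -- chainSum B S t A q is the sum, over chains A ⊊ F₁ ⊊ ⋯ ⊊ Fₜ of members of S and over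
  -- exponents 1 ≤ pᵢ ≤ R, of ∏ᵢ C(d Fᵢ ∸ qᵢ₋₁, pᵢ) (xf Fᵢ)^pᵢ times B qₜ, where q₀ = q and
  -- qᵢ = qᵢ₋₁ + pᵢ; cap F B is the terminal function of chains that are continued by F.
  cap : Subset n → (ℕ → Poly V) → ℕ → Poly V
  cap F B q = ∑[ p < R ] weight (xf F) (d F) q (suc p) ⊗ B (q + suc p)

  chainSum : (ℕ → Poly V) → List (Subset n) → ℕ → Subset n → ℕ → Poly V
  chainSum B S zero    A q = B q
  chainSum B S (suc t) A q = ∑[ F ∈ filter (dec⊂ A) S ] cap F (chainSum B S t F) q

  cap-cong : ∀ F {B B′} → (∀ q → B q ≈ B′ q) → ∀ q → cap F B q ≈ cap F B′ q
  cap-cong F B≈B′ q = ∑<-cong R (λ p _ → ⊗-cong refl′ (B≈B′ _))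

  cap-⊕ : ∀ F B B′ q → cap F (λ q′ → B q′ ⊕ B′ q′) q ≈ cap F B q ⊕ cap F B′ q
  cap-⊕ F B B′ q = trans′ (∑<-cong R (λ p _ → distribˡ _ _ _)) (∑<-⊕ _ _ R)

  cap-guard : ∀ {P : Set} (a : Dec P) F B q → cap F (λ q′ → guard a (B q′)) q ≈ guard a (cap F B q)
  cap-guard (yes _) F B q = refl′
  cap-guard (no _)  F B q = ∑<-vanish R (λ p _ → zeroʳ _)

  cap-linear : ∀ F (a : ℕ → Poly V) (B : ℕ → ℕ → Poly V) T q →
               cap F (λ q′ → ∑[ m < T ] a m ⊗ B m q′) q ≈ ∑[ m < T ] a m ⊗ cap F (B m) q
  cap-linear F a B T q = begin
    ∑[ p < R ] w p ⊗ (∑[ m < T ] a m ⊗ B m (q + suc p))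
      ≈⟨ ∑<-cong R (λ p _ → trans′ (*-∑< (w p) _ T) (∑<-cong T (λ m _ → exchange (w p) (a m) _))) ⟩
    ∑[ p < R ] ∑[ m < T ] a m ⊗ (w p ⊗ B m (q + suc p))
      ≈⟨ ∑<-swap _ R T ⟩
    ∑[ m < T ] ∑[ p < R ] a m ⊗ (w p ⊗ B m (q + suc p))
      ≈⟨ ∑<-cong T (λ m _ → sym′ (*-∑< (a m) _ R)) ⟩
    ∑[ m < T ] a m ⊗ cap F (B m) q ∎
    where
    w : ℕ → Poly V
    w p = weight (xf F) (d F) q (suc p)
    exchange : ∀ u v e → u ⊗ (v ⊗ e) ≈ v ⊗ (u ⊗ e)
    exchange = solve 3 (λ u v e → u :* (v :* e) := v :* (u :* e)) refl′

  chainSum-cong : ∀ {B B′} → (∀ q → B q ≈ B′ q) → ∀ S t A q → chainSum B S t A q ≈ chainSum B′ S t A q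
  chainSum-cong B≈B′ S zero    A q = B≈B′ q
  chainSum-cong B≈B′ S (suc t) A q =
    ∑-cong (filter (dec⊂ A) S) (λ F → cap-cong F (chainSum-cong B≈B′ S t F) q)

  chainSum-linear : ∀ (a : ℕ → Poly V) (B : ℕ → ℕ → Poly V) T S t A q →
                    chainSum (λ q′ → ∑[ m < T ] a m ⊗ B m q′) S t A q ≈ ∑[ m < T ] a m ⊗ chainSum (B m) S t A q
  chainSum-linear a B T S zero    A q = refl′
  chainSum-linear a B T S (suc t) A q = begin
    ∑[ F ∈ filter (dec⊂ A) S ] cap F (chainSum (λ q′ → ∑[ m < T ] a m ⊗ B m q′) S t F) q
      ≈⟨ ∑-cong (filter (dec⊂ A) S) (λ F → trans′ (cap-cong F (chainSum-linear a B T S t F) q)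
                                                   (cap-linear F a (λ m → chainSum (B m) S t F) T q)) ⟩
    ∑[ F ∈ filter (dec⊂ A) S ] ∑[ m < T ] a m ⊗ cap F (chainSum (B m) S t F) q
      ≈⟨ sym′ (∑<-∑-swap _ T (filter (dec⊂ A) S)) ⟩
    ∑[ m < T ] ∑[ F ∈ filter (dec⊂ A) S ] a m ⊗ cap F (chainSum (B m) S t F) q
      ≈⟨ ∑<-cong T (λ m _ → sym′ (*-∑ (a m) _ (filter (dec⊂ A) S))) ⟩
    ∑[ m < T ] a m ⊗ chainSum (B m) S (suc t) A q ∎

  chainSum-vanish : ∀ B b → (∀ q → b ≤ q → B q ≈ 0#) → ∀ S t A q → b ≤ q + t → chainSum B S t A q ≈ 0#
  chainSum-vanish B b B≈0 S zero    A q b≤q+0 = B≈0 q (≡.subst (b ≤_) (ℕ.+-identityʳ q) b≤q+0)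
  chainSum-vanish B b B≈0 S (suc t) A q b≤q+1+t =
    ∑-vanish (filter (dec⊂ A) S) (λ F → ∑<-vanish R (λ p _ →
      *-≈0ʳ _ (chainSum-vanish B b B≈0 S t F (q + suc p) (b≤ p))))
    where
    b≤ : ∀ p → b ≤ q + suc p + t
    b≤ p = ℕ.≤-trans b≤q+1+t (≡.subst (q + suc t ≤_) (≡.sym (ℕ.+-assoc q (suc p) t))
                                      (ℕ.+-monoʳ-≤ q (s≤s (ℕ.m≤n+m t p))))

  chainSum-from-maximal : ∀ H S → All (H ⊈_) S → ∀ B t q → chainSum B (H ∷ S) (suc t) H q ≈ 0#
  chainSum-from-maximal H S H⊈S B t q =
    ≡⇒≈ (≡.cong (λ Fs → ∑ Fs (λ F → cap F (chainSum B (H ∷ S) t F) q))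
                 (List.filter-none (dec⊂ H) (⊂-irref refl ∷ All.map (λ H⊈F → H⊈F ∘ p⊂q⇒p⊆q) H⊈S)))

  chainSum-∷-maximal : ∀ H S → All (H ⊈_) S → ∀ B t A q →
                       chainSum B (H ∷ S) (suc t) A q ≈
                       chainSum B S (suc t) A q ⊕ guard (dec⊂ A H) (chainSum (cap H B) (below H S) t A q)
  chainSum-∷-maximal H S H⊈S B zero    A q = ∑-filter-∷ (dec⊂ A) (λ F → cap F B q) H S
  chainSum-∷-maximal H S H⊈S B (suc t) A q = begin
    chainSum B (H ∷ S) (suc (suc t)) A q
      ≈⟨ ∑-filter-∷-vanish (dec⊂ A) _ (∑<-vanish R (λ p _ → *-≈0ʳ _ (chainSum-from-maximal H S H⊈S B t _)))
                                      S ⟩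
    ∑[ F ∈ filter (dec⊂ A) S ] cap F (chainSum B (H ∷ S) (suc t) F) q
      ≈⟨ ∑-cong (filter (dec⊂ A) S) split ⟩
    ∑[ F ∈ filter (dec⊂ A) S ] (cap F (chainSum B S (suc t) F) q ⊕ guard (dec⊂ F H) (g F))
      ≈⟨ ∑-⊕ _ _ (filter (dec⊂ A) S) ⟩
    chainSum B S (suc (suc t)) A q ⊕ (∑[ F ∈ filter (dec⊂ A) S ] guard (dec⊂ F H) (g F))
      ≈⟨ ⊕-cong refl′ (∑-filter-guard (dec⊂ A) (λ F → dec⊂ F H) (dec⊂ A H) ⊂-trans g S) ⟩
    chainSum B S (suc (suc t)) A q ⊕ guard (dec⊂ A H) (chainSum (cap H B) (below H S) (suc t) A q) ∎
    where
    g : Subset n → Poly V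
    g F = cap F (chainSum (cap H B) (below H S) t F) q
    split : ∀ F → cap F (chainSum B (H ∷ S) (suc t) F) q ≈ cap F (chainSum B S (suc t) F) q ⊕ guard (dec⊂ F H) (g F)
    split F = begin
      cap F (chainSum B (H ∷ S) (suc t) F) q
        ≈⟨ cap-cong F (chainSum-∷-maximal H S H⊈S B t F) q ⟩
      cap F (λ q′ → chainSum B S (suc t) F q′ ⊕ guard (dec⊂ F H) (chainSum (cap H B) (below H S) t F q′)) q
        ≈⟨ cap-⊕ F (chainSum B S (suc t) F) (guard (dec⊂ F H) ∘ chainSum (cap H B) (below H S) t F) q ⟩
      cap F (chainSum B S (suc t) F) q ⊕ cap F (λ q′ → guard (dec⊂ F H) (chainSum (cap H B) (below H S) t F q′)) q
        ≈⟨ ⊕-cong refl′ (cap-guard (dec⊂ F H) F (chainSum (cap H B) (below H S) t F) q) ⟩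
      cap F (chainSum B S (suc t) F) q ⊕ guard (dec⊂ F H) (g F) ∎

  ∑chainSum-∷-maximal : ∀ H S → All (H ⊈_) S → ∀ B A → A ⊂ H → ∀ T q →
                        ∑[ t < suc T ] chainSum B (H ∷ S) t A q ≈
                        (∑[ t < suc T ] chainSum B S t A q) ⊕ (∑[ t < T ] chainSum (cap H B) (below H S) t A q)
  ∑chainSum-∷-maximal H S H⊈S B A A⊂H T q = begin
    ∑[ t < suc T ] chainSum B (H ∷ S) t A q
      ≈⟨ ∑<-suc _ T ⟩
    B q ⊕ (∑[ t < T ] chainSum B (H ∷ S) (suc t) A q)
      ≈⟨ ⊕-cong refl′ (∑<-cong T (λ t _ → trans′ (chainSum-∷-maximal H S H⊈S B t A q)
                                                  (⊕-cong refl′ (guard-yes A⊂H (dec⊂ A H) _)))) ⟩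
    B q ⊕ (∑[ t < T ] (chainSum B S (suc t) A q ⊕ chainSum (cap H B) (below H S) t A q))
      ≈⟨ trans′ (⊕-cong refl′ (∑<-⊕ _ _ T)) (sym′ (⊕-assoc _ _ _)) ⟩
    (B q ⊕ (∑[ t < T ] chainSum B S (suc t) A q)) ⊕ (∑[ t < T ] chainSum (cap H B) (below H S) t A q)
      ≈⟨ ⊕-cong (sym′ (∑<-suc _ T)) refl′ ⟩
    (∑[ t < suc T ] chainSum B S t A q) ⊕ (∑[ t < T ] chainSum (cap H B) (below H S) t A q) ∎

  at : ℕ → ℕ → Poly V
  at j q = 𝟙 (q ℕ.≟ j)

  cap-at : ∀ H j → j ≤ R → ∀ q → cap H (at j) q ≈ guard (q ℕ.<? j) (weight (xf H) (d H) q (j ∸ q))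
  cap-at H j j≤R q with q ℕ.<? j
  ... | yes q<j = begin
    ∑[ p < R ] w p ⊗ 𝟙 (q + suc p ℕ.≟ j)
      ≈⟨ ∑<-cong R (λ p _ → ⊗-cong refl′ (guard-⇔ to (from p) (q + suc p ℕ.≟ j) (j ∸ suc q ℕ.≟ p) _)) ⟩
    ∑[ p < R ] w p ⊗ 𝟙 (j ∸ suc q ℕ.≟ p)
      ≈⟨ ∑<-sift w (j ∸ suc q) R ⟩
    guard (j ∸ suc q ℕ.<? R) (w (j ∸ suc q))
      ≈⟨ guard-yes (≡.subst (_≤ R) (suc-∸ q<j) (ℕ.≤-trans (ℕ.m∸n≤m j q) j≤R)) (j ∸ suc q ℕ.<? R) _ ⟩
    w (j ∸ suc q)
      ≡⟨ ≡.cong (weight (xf H) (d H) q) (≡.sym (suc-∸ q<j)) ⟩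
    weight (xf H) (d H) q (j ∸ q) ∎
    where
    w : ℕ → Poly V
    w p = weight (xf H) (d H) q (suc p)
    to : ∀ {p} → q + suc p ≡ j → j ∸ suc q ≡ p
    to {p} refl = ≡.trans (≡.cong (_∸ suc q) (ℕ.+-suc q p)) (ℕ.m+n∸m≡n (suc q) p)
    from : ∀ p → j ∸ suc q ≡ p → q + suc p ≡ j
    from _ refl = ≡.trans (≡.cong (λ m → q + m) (≡.sym (suc-∸ q<j))) (ℕ.m+[n∸m]≡n (ℕ.<⇒≤ q<j))
  ... | no q≮j = ∑<-vanish R (λ p _ → *-≈0ʳ _ (guard-no (q≮j ∘ below-j p) (q + suc p ℕ.≟ j) _))
    where
    below-j : ∀ p → q + suc p ≡ j → q < j
    below-j p refl = ℕ.m<m+n q (s≤s z≤n)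

-- An abstract form of A*(M): xf F stands for x_F and δ i F for the rank jump of F from Mᵢ to Mᵢ₊₁.
module ChainExpansion
  (G : Poly V → Set) {n : ℕ}
  (Good : Subset n → Set) (d : Subset n → ℕ) (xf : Subset n → Poly V)
  {Idx : Set} (I : List Idx) (δ : Idx → Subset n → ℕ)
  (xf-incomparable : ∀ {F F′} → Good F → Good F′ → Incomparable F F′ → Eqv G (xf F ⊗ xf F′) (con (+ 0)))
  (good-nonempty : ∀ {F} → Good F → ∅ ⊂ F)
  (δ≤1 : ∀ {i F} → i ∈ᴸ I → Good F → δ i F ≤ 1)
  (Σδ≡d : ∀ {F} → Good F → sum (map (λ i → δ i F) I) ≡ d F)
  (δ-downward : ∀ {i F F′} → i ∈ᴸ I → Good F → Good F′ → F′ ⊂ F → δ i F ≡ 0 → δ i F′ ≡ 0)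
  where

  open QuotientRing G
  open Sums G
  open Symmetric G
  open import Relation.Binary.Reasoning.Setoid setoid

  ℓ : List (Subset n) → Idx → Poly V
  ℓ S i = ∑[ F ∈ S ] ⌜ δ i F ⌝ ⊗ xf F

  module _ {H : Subset n} (good-H : Good H) {S : List (Subset n)} (good-S : All Good S) (H⊈S : All (H ⊈_) S) where

    open Splitting (xf H) (λ i → δ i H) (ℓ S) (ℓ (below H S)) using (Splits; esym-split)

    ℓ-absorb : ∀ i → xf H ⊗ ℓ S i ≈ xf H ⊗ ℓ (below H S) i
    ℓ-absorb i = begin
      xf H ⊗ ℓ S i                                            ≈⟨ *-∑ (xf H) _ S ⟩
      ∑[ F ∈ S ] xf H ⊗ term F                                ≈⟨ ∑-congᴬ (All.zip (good-S , H⊈S)) keep-below ⟩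
      ∑[ F ∈ S ] guard (dec⊂ F H) (xf H ⊗ term F)             ≈⟨ sym′ (∑-filter (λ F → dec⊂ F H) _ S) ⟩
      ∑[ F ∈ below H S ] xf H ⊗ term F                        ≈⟨ sym′ (*-∑ (xf H) _ (below H S)) ⟩
      xf H ⊗ ℓ (below H S) i                                  ∎
      where
      term : Subset n → Poly V
      term F = ⌜ δ i F ⌝ ⊗ xf F
      keep-below : ∀ {F} → Good F × H ⊈ F → xf H ⊗ term F ≈ guard (dec⊂ F H) (xf H ⊗ term F)
      keep-below {F} (good-F , H⊈F) with dec⊂ F H
      ... | yes _   = refl′
      ... | no  F⊄H = begin
        xf H ⊗ (⌜ δ i F ⌝ ⊗ xf F)
          ≈⟨ solve 3 (λ h c f → h :* (c :* f) := c :* (h :* f)) refl′ (xf H) ⌜ δ i F ⌝ (xf F) ⟩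
        ⌜ δ i F ⌝ ⊗ (xf H ⊗ xf F)
          ≈⟨ *-≈0ʳ _ (xf-incomparable good-H good-F (H⊈F , H⊈F ∘ F⊆H⇒H⊆F)) ⟩
        0# ∎
        where
        F⊆H⇒H⊆F : F ⊆ H → H ⊆ F
        F⊆H⇒H⊆F F⊆H = ⊆∧⊄⇒⊇ F⊆H F⊄H

    ℓ-below-vanish : ∀ {i} → i ∈ᴸ I → δ i H ≡ 0 → ℓ (below H S) i ≈ 0#
    ℓ-below-vanish {i} i∈I δ≡0 = trans′ (∑-congᴬ (All.zip (good-below , below-H)) term≈0) (∑-zero (below H S))
      where
      good-below = Allₚ.filter⁺ (λ F → dec⊂ F H) good-S
      below-H    = Allₚ.all-filter (λ F → dec⊂ F H) S
      term≈0 : ∀ {F} → Good F × F ⊂ H → ⌜ δ i F ⌝ ⊗ xf F ≈ 0#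
      term≈0 (good-F , F⊂H) = *-≈0ˡ _ (≡⇒≈ (≡.cong ⌜_⌝ (δ-downward i∈I good-H good-F F⊂H δ≡0)))

    splits : Splits I
    splits = All.tabulate split
      where
      split : ∀ {i} → i ∈ᴸ I → Split (xf H) (δ i H) (ℓ S i) (ℓ (below H S) i)
      split {i} i∈I with ≤1⇒≡0⊎≡1 (δ≤1 i∈I good-H)
      ... | inj₁ δ≡0 = flat δ≡0 (ℓ-below-vanish i∈I δ≡0) (ℓ-absorb i)
      ... | inj₂ δ≡1 = up δ≡1 (ℓ-absorb i)

    esym-split-maximal : ∀ j → esym (map (ℓ (H ∷ S)) I) j ≈
                               esym (map (ℓ S) I) j ⊕ xSum (xf H) (d H) (map (ℓ (below H S)) I) j
    esym-split-maximal j = trans′ (esym-split I splits j)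
      (≡⇒≈ (≡.cong (λ c → esym (map (ℓ S) I) j ⊕ xSum (xf H) c (map (ℓ (below H S)) I) j) (Σδ≡d good-H)))

  module _ (R : ℕ) where

    open Chains G d xf R

    ChainExpansionAt : List (Subset n) → ℕ → Set
    ChainExpansionAt S j = esym (map (ℓ S) I) j ≈ ∑[ t < suc R ] chainSum (at j) S t ∅ 0

    xSum-expansion : ∀ H S → (∀ i → i ≤ R → ChainExpansionAt S i) → ∀ j → j ≤ R →
                     xSum (xf H) (d H) (map (ℓ S) I) j ≈ ∑[ t < R ] chainSum (cap H (at j)) S t ∅ 0
    xSum-expansion H S expansion-S j j≤R = begin
      ∑[ i < j ] w i ⊗ esym (map (ℓ S) I) i
        ≈⟨ ∑<-cong j (λ i i<j → trans′ (⊗-cong refl′ (expansion-S i (ℕ.<⇒≤ (ℕ.<-≤-trans i<j j≤R))))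
                                        (*-∑< (w i) _ (suc R))) ⟩
      ∑[ i < j ] ∑[ t < suc R ] w i ⊗ chainSum (at i) S t ∅ 0
        ≈⟨ ∑<-swap _ j (suc R) ⟩
      ∑[ t < suc R ] ∑[ i < j ] w i ⊗ chainSum (at i) S t ∅ 0
        ≈⟨ ∑<-cong (suc R) (λ t _ → sym′ (chainSum-linear w at j S t ∅ 0)) ⟩
      ∑[ t < suc R ] chainSum (λ q → ∑[ i < j ] w i ⊗ at i q) S t ∅ 0
        ≈⟨ ∑<-cong (suc R) (λ t _ → chainSum-cong sift S t ∅ 0) ⟩
      ∑[ t < suc R ] chainSum (cap H (at j)) S t ∅ 0
        ≈⟨ ∑<-truncate _ R (suc R) (ℕ.n≤1+n R)
             (λ t R≤t _ → chainSum-vanish (cap H (at j)) j cap-vanish S t ∅ 0 (ℕ.≤-trans j≤R R≤t)) ⟩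
      ∑[ t < R ] chainSum (cap H (at j)) S t ∅ 0 ∎
      where
      w : ℕ → Poly V
      w i = weight (xf H) (d H) i (j ∸ i)
      sift : ∀ q → ∑[ i < j ] w i ⊗ at i q ≈ cap H (at j) q
      sift q = trans′ (∑<-sift w q j) (sym′ (cap-at H j j≤R q))
      cap-vanish : ∀ q → j ≤ q → cap H (at j) q ≈ 0#
      cap-vanish q j≤q = trans′ (cap-at H j j≤R q) (guard-no (ℕ.≤⇒≯ j≤q) (q ℕ.<? j) _)

    -- The fuel N is needed because the recursion passes to below H S, which is not a sub-term of H ∷ S.
    expansion-bounded : ∀ N S → length S ≤ N → All Good S → AllPairs _⊈_ S →
                        ∀ j → j ≤ R → ChainExpansionAt S j
    expansion-bounded N       []      _          _                 _                j j≤R = begin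
      esym (map (λ _ → 0#) I) j                                 ≈⟨ esym-zeros I j ⟩
      𝟙 (0 ℕ.≟ j)                                               ≈⟨ sym′ (+-identityʳ _) ⟩
      𝟙 (0 ℕ.≟ j) ⊕ 0#                                          ≈⟨ ⊕-cong refl′ (sym′ (∑<-zero R)) ⟩
      𝟙 (0 ℕ.≟ j) ⊕ (∑[ t < R ] chainSum (at j) [] (suc t) ∅ 0) ≈⟨ sym′ (∑<-suc _ R) ⟩
      ∑[ t < suc R ] chainSum (at j) [] t ∅ 0                   ∎
    expansion-bounded (suc N) (H ∷ S) (s≤s |S|≤N) (good-H ∷ good-S) (H⊈S ∷ pairs-S) j j≤R = begin
      esym (map (ℓ (H ∷ S)) I) j
        ≈⟨ esym-split-maximal good-H good-S H⊈S j ⟩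
      esym (map (ℓ S) I) j ⊕ xSum (xf H) (d H) (map (ℓ (below H S)) I) j
        ≈⟨ ⊕-cong (expansion-bounded N S |S|≤N good-S pairs-S j j≤R)
                  (xSum-expansion H (below H S) expansion-below j j≤R) ⟩
      (∑[ t < suc R ] chainSum (at j) S t ∅ 0) ⊕ (∑[ t < R ] chainSum (cap H (at j)) (below H S) t ∅ 0)
        ≈⟨ sym′ (∑chainSum-∷-maximal H S H⊈S (at j) ∅ (good-nonempty good-H) R 0) ⟩
      ∑[ t < suc R ] chainSum (at j) (H ∷ S) t ∅ 0 ∎
      where
      expansion-below : ∀ i → i ≤ R → ChainExpansionAt (below H S) i
      expansion-below = expansion-bounded N (below H S)
        (ℕ.≤-trans (List.length-filter (λ F → dec⊂ F H) S) |S|≤N)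
        (Allₚ.filter⁺ (λ F → dec⊂ F H) good-S) (AllPairsₚ.filter⁺ (λ F → dec⊂ F H) pairs-S)

    expansion : ∀ S → All Good S → AllPairs _⊈_ S → ∀ j → j ≤ R → ChainExpansionAt S j
    expansion S = expansion-bounded (length S) S ℕ.≤-refl

-- Ranks, closures and quotients of matroids

∪-least : ∀ {n} {P Q S : Subset n} → P ⊆ S → Q ⊆ S → P ∪ Q ⊆ S
∪-least {P = P} {Q} P⊆S Q⊆S x∈P∪Q = [ P⊆S , Q⊆S ]′ (x∈p∪q⁻ P Q x∈P∪Q)

⁅⁆-⊆ : ∀ {n} {e} {Y : Subset n} → e ∈ Y → ⁅ e ⁆ ⊆ Y
⁅⁆-⊆ e∈Y x∈⁅e⁆ = ≡.subst (_∈ _) (≡.sym (x∈⁅y⁆⇒x≡y _ x∈⁅e⁆)) e∈Y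

infixl 6 _∪*_
_∪*_ : ∀ {n} → Subset n → List (Fin n) → Subset n
X ∪* []       = X
X ∪* (f ∷ fs) = (X ∪* fs) ∪ ⁅ f ⁆

⊆-∪* : ∀ {n} (X : Subset n) fs → X ⊆ X ∪* fs
⊆-∪* X []       = λ x∈X → x∈X
⊆-∪* X (f ∷ fs) = p⊆p∪q ⁅ f ⁆ ∘ ⊆-∪* X fs

∈ᴸ⇒∈-∪* : ∀ {n} (X : Subset n) {e} fs → e ∈ᴸ fs → e ∈ X ∪* fs
∈ᴸ⇒∈-∪* X (f ∷ fs) (here refl) = q⊆p∪q (X ∪* fs) ⁅ f ⁆ (x∈⁅x⁆ f)
∈ᴸ⇒∈-∪* X (f ∷ fs) (there e∈fs) = p⊆p∪q ⁅ f ⁆ (∈ᴸ⇒∈-∪* X fs e∈fs)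

∪*-least : ∀ {n} {X Y : Subset n} fs → X ⊆ Y → All (_∈ Y) fs → X ∪* fs ⊆ Y
∪*-least []       X⊆Y _             = X⊆Y
∪*-least (f ∷ fs) X⊆Y (f∈Y ∷ fs⊆Y) = ∪-least (∪*-least fs X⊆Y fs⊆Y) (⁅⁆-⊆ f∈Y)

elements : ∀ {n} → Subset n → List (Fin n)
elements {n} Y = filter (_∈? Y) (allFin n)

∪*-elements : ∀ {n} {X Y : Subset n} → X ⊆ Y → X ∪* elements Y ⊆ Y × Y ⊆ X ∪* elements Y
∪*-elements {n} {X} {Y} X⊆Y =
  ∪*-least (elements Y) X⊆Y (Allₚ.all-filter (_∈? Y) (allFin n)) ,
  λ e∈Y → ∈ᴸ⇒∈-∪* X (elements Y) (∈-filter⁺ (_∈? Y) (∈-allFin _) e∈Y)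

difference-trans : ∀ a b c d m p → a + m ≤ b + p → p + c ≤ m + d → a + c ≤ b + d
difference-trans a b c d m p h₁ h₂ = ℕ.+-cancelʳ-≤ (m + p) (a + c) (b + d) (begin
  a + c + (m + p)   ≡⟨ solve 4 (λ a c m p → a :+ c :+ (m :+ p) := (a :+ m) :+ (p :+ c)) refl a c m p ⟩
  (a + m) + (p + c) ≤⟨ ℕ.+-mono-≤ h₁ h₂ ⟩
  (b + p) + (m + d) ≡⟨ solve 4 (λ b p m d → (b :+ p) :+ (m :+ d) := b :+ d :+ (m :+ p)) refl b p m d ⟩
  b + d + (m + p)   ∎)
  where
  open ℕ.≤-Reasoning
  open import Data.Nat.Solver using (module +-*-Solver)
  open +-*-Solver

module MatroidRank {n : ℕ} (M : Matroid n) where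

  open ℕ.≤-Reasoning

  mono : ∀ {X Y} → X ⊆ Y → rk M X ≤ rk M Y
  mono {X} {Y} = rk-mono M X Y

  rk-cong : ∀ {X Y} → X ⊆ Y → Y ⊆ X → rk M X ≡ rk M Y
  rk-cong X⊆Y Y⊆X = ℕ.≤-antisym (mono X⊆Y) (mono Y⊆X)

  rk-∅ : rk M ∅ ≡ 0
  rk-∅ = ℕ.n≤0⇒n≡0 (≡.subst (rk M ∅ ≤_) (∣⊥∣≡0 n) (rk-bound M ∅))

  rk-∪⁅⁆ : ∀ X e → rk M (X ∪ ⁅ e ⁆) ≤ suc (rk M X)
  rk-∪⁅⁆ X e = begin
    rk M (X ∪ ⁅ e ⁆)                        ≤⟨ ℕ.m≤m+n _ _ ⟩
    rk M (X ∪ ⁅ e ⁆) + rk M (X ∩ ⁅ e ⁆)     ≤⟨ rk-submod M X ⁅ e ⁆ ⟩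
    rk M X + rk M ⁅ e ⁆                     ≤⟨ ℕ.+-monoʳ-≤ (rk M X) rk-⁅e⁆≤1 ⟩
    rk M X + 1                              ≡⟨ ℕ.+-comm (rk M X) 1 ⟩
    suc (rk M X)                            ∎
    where
    rk-⁅e⁆≤1 : rk M ⁅ e ⁆ ≤ 1
    rk-⁅e⁆≤1 = ≡.subst (rk M ⁅ e ⁆ ≤_) (∣⁅x⁆∣≡1 e) (rk-bound M ⁅ e ⁆)

  rk-diminishing : ∀ {X Y} e → X ⊆ Y → rk M (Y ∪ ⁅ e ⁆) + rk M X ≤ rk M Y + rk M (X ∪ ⁅ e ⁆)
  rk-diminishing {X} {Y} e X⊆Y = begin
    rk M (Y ∪ ⁅ e ⁆) + rk M X
      ≤⟨ ℕ.+-mono-≤ (mono (∪-least (p⊆p∪q _) (q⊆p∪q Y _ ∘ q⊆p∪q X ⁅ e ⁆)))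
                    (mono (λ x∈X → x∈p∩q⁺ (X⊆Y x∈X , p⊆p∪q ⁅ e ⁆ x∈X))) ⟩
    rk M (Y ∪ (X ∪ ⁅ e ⁆)) + rk M (Y ∩ (X ∪ ⁅ e ⁆))
      ≤⟨ rk-submod M Y (X ∪ ⁅ e ⁆) ⟩
    rk M Y + rk M (X ∪ ⁅ e ⁆) ∎

  rk-∪*-stable : ∀ X fs → All (λ f → rk M (X ∪ ⁅ f ⁆) ≡ rk M X) fs → rk M (X ∪* fs) ≡ rk M X
  rk-∪*-stable X []       _            = refl
  rk-∪*-stable X (f ∷ fs) (f-stable ∷ fs-stable) = ℕ.≤-antisym
    (ℕ.+-cancelʳ-≤ (rk M X) _ _ (begin
      rk M ((X ∪* fs) ∪ ⁅ f ⁆) + rk M X   ≤⟨ rk-diminishing f (⊆-∪* X fs) ⟩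
      rk M (X ∪* fs) + rk M (X ∪ ⁅ f ⁆)   ≡⟨ ≡.cong₂ _+_ (rk-∪*-stable X fs fs-stable) f-stable ⟩
      rk M X + rk M X                     ∎))
    (mono (⊆-∪* X (f ∷ fs)))

  cl : Subset n → Subset n
  cl X = tabulate (λ e → does (rk M (X ∪ ⁅ e ⁆) ℕ.≟ rk M X))

  ∈-cl⁻ : ∀ {X e} → e ∈ cl X → rk M (X ∪ ⁅ e ⁆) ≡ rk M X
  ∈-cl⁻ {X} {e} e∈cl = ℕ.≡ᵇ⇒≡ (rk M (X ∪ ⁅ e ⁆)) (rk M X)
    (≡.subst T (≡.trans (≡.sym (Vecₚ.[]=⇒lookup e∈cl)) (Vecₚ.lookup∘tabulate _ e)) _)

  ∈-cl⁺ : ∀ {X e} → rk M (X ∪ ⁅ e ⁆) ≡ rk M X → e ∈ cl X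
  ∈-cl⁺ {X} {e} stable = Vecₚ.lookup⇒[]= e (cl X)
    (≡.trans (Vecₚ.lookup∘tabulate _ e) (dec-true (rk M (X ∪ ⁅ e ⁆) ℕ.≟ rk M X) stable))

  ⊆-cl : ∀ X → X ⊆ cl X
  ⊆-cl X e∈X = ∈-cl⁺ (rk-cong (∪-least (λ x∈X → x∈X) (⁅⁆-⊆ e∈X)) (p⊆p∪q _))

  rk-cl : ∀ X → rk M (cl X) ≡ rk M X
  rk-cl X = ℕ.≤-antisym
    (begin
      rk M (cl X)            ≤⟨ mono (∈ᴸ⇒∈-∪* X stable ∘ ∈-filter⁺ stable? (∈-allFin _) ∘ ∈-cl⁻) ⟩
      rk M (X ∪* stable)     ≡⟨ rk-∪*-stable X stable (Allₚ.all-filter stable? (allFin n)) ⟩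
      rk M X                 ∎)
    (mono (⊆-cl X))
    where
    stable? = λ e → rk M (X ∪ ⁅ e ⁆) ℕ.≟ rk M X
    stable = filter stable? (allFin n)

  flat-rank-increase : ∀ {F X e} → IsFlat M F → X ⊆ F → e ∉ F → rk M X < rk M (X ∪ ⁅ e ⁆)
  flat-rank-increase {F} {X} {e} F-flat X⊆F e∉F = ℕ.≰⇒> λ no-increase →
    ℕ.<⇒≱ (F-flat e e∉F) (ℕ.+-cancelʳ-≤ (rk M X) _ _ (begin
      rk M (F ∪ ⁅ e ⁆) + rk M X   ≤⟨ rk-diminishing e X⊆F ⟩
      rk M F + rk M (X ∪ ⁅ e ⁆)   ≤⟨ ℕ.+-monoʳ-≤ (rk M F) no-increase ⟩
      rk M F + rk M X             ∎))

  cl-flat : ∀ X → IsFlat M (cl X)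
  cl-flat X e e∉cl = begin-strict
    rk M (cl X)          ≡⟨ rk-cl X ⟩
    rk M X               <⟨ ℕ.≤∧≢⇒< (mono (p⊆p∪q ⁅ e ⁆)) (e∉cl ∘ ∈-cl⁺ ∘ ≡.sym) ⟩
    rk M (X ∪ ⁅ e ⁆)     ≤⟨ mono (∪-least (p⊆p∪q ⁅ e ⁆ ∘ ⊆-cl X) (q⊆p∪q (cl X) ⁅ e ⁆)) ⟩
    rk M (cl X ∪ ⁅ e ⁆)  ∎

module Quotient {n : ℕ} (Q N : Matroid n) (Q-quotient : IsQuotient Q N) where

  private
    module Q = MatroidRank Q
    module N = MatroidRank N
  open ℕ.≤-Reasoning

  rk-gap-step : ∀ X e → rk Q (X ∪ ⁅ e ⁆) + rk N X ≤ rk N (X ∪ ⁅ e ⁆) + rk Q X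
  rk-gap-step X e with e ∈? Q.cl X
  ... | yes e∈cl = begin
    rk Q (X ∪ ⁅ e ⁆) + rk N X   ≡⟨ ≡.cong (_+ rk N X) (Q.∈-cl⁻ e∈cl) ⟩
    rk Q X + rk N X             ≡⟨ ℕ.+-comm (rk Q X) (rk N X) ⟩
    rk N X + rk Q X             ≤⟨ ℕ.+-monoˡ-≤ (rk Q X) (N.mono (p⊆p∪q ⁅ e ⁆)) ⟩
    rk N (X ∪ ⁅ e ⁆) + rk Q X   ∎
  ... | no e∉cl = begin
    rk Q (X ∪ ⁅ e ⁆) + rk N X   ≤⟨ ℕ.+-monoˡ-≤ (rk N X) (Q.rk-∪⁅⁆ X e) ⟩
    suc (rk Q X) + rk N X       ≡⟨ ≡.sym (ℕ.+-suc (rk Q X) (rk N X)) ⟩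
    rk Q X + suc (rk N X)       ≤⟨ ℕ.+-monoʳ-≤ (rk Q X) N-increase ⟩
    rk Q X + rk N (X ∪ ⁅ e ⁆)   ≡⟨ ℕ.+-comm (rk Q X) _ ⟩
    rk N (X ∪ ⁅ e ⁆) + rk Q X   ∎
    where
    N-increase : rk N X < rk N (X ∪ ⁅ e ⁆)
    N-increase = N.flat-rank-increase (Q-quotient _ (Q.cl-flat X)) (Q.⊆-cl X) e∉cl

  rk-gap-∪* : ∀ X fs → rk Q (X ∪* fs) + rk N X ≤ rk N (X ∪* fs) + rk Q X
  rk-gap-∪* X []       = ℕ.≤-reflexive (ℕ.+-comm (rk Q X) (rk N X))
  rk-gap-∪* X (f ∷ fs) =
    difference-trans (rk Q (X′ ∪ ⁅ f ⁆)) (rk N (X′ ∪ ⁅ f ⁆)) (rk N X) (rk Q X) (rk N X′) (rk Q X′)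
                     (rk-gap-step X′ f) (rk-gap-∪* X fs)
    where X′ = X ∪* fs

  rk-gap-mono : ∀ {X Y} → X ⊆ Y → rk Q Y + rk N X ≤ rk N Y + rk Q X
  rk-gap-mono {X} {Y} X⊆Y with ∪*-elements X⊆Y
  ... | X∪Y⊆Y , Y⊆X∪Y = ≡.subst₂ (λ q m → q + rk N X ≤ m + rk Q X)
                          (Q.rk-cong X∪Y⊆Y Y⊆X∪Y) (N.rk-cong X∪Y⊆Y Y⊆X∪Y) (rk-gap-∪* X (elements Y))

-- The Chow ring of a matroid

allSubsets-⊈ : ∀ n → AllPairs _⊈_ (allSubsets n)
allSubsets-⊈ zero    = [] ∷ []
allSubsets-⊈ (suc n) =
  AllPairsₚ.++⁺ (extend inside) (extend outside) (Allₚ.map⁺ (All.universal inside⊈outsides (allSubsets n)))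
  where
  ∷-⊈ : ∀ s {A B : Subset n} → A ⊈ B → (s Vec.∷ A) ⊈ (s Vec.∷ B)
  ∷-⊈ s A⊈B sA⊆sB = A⊈B (drop-∷-⊆ sA⊆sB)
  extend : ∀ s → AllPairs _⊈_ (map (s Vec.∷_) (allSubsets n))
  extend s = AllPairsₚ.map⁺ (AllPairs.map (∷-⊈ s) (allSubsets-⊈ n))
  inside⊈outside : ∀ {A B : Subset n} → (inside Vec.∷ A) ⊈ (outside Vec.∷ B)
  inside⊈outside sA⊆sB with sA⊆sB Vec.here
  ... | ()
  inside⊈outsides : ∀ A → All ((inside Vec.∷ A) ⊈_) (map (outside Vec.∷_) (allSubsets n))
  inside⊈outsides A = Allₚ.map⁺ (All.universal (λ _ → inside⊈outside) (allSubsets n))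

ifT-yes : ∀ {A : Set} b (t : T b) {f : T b → A} {a} → ifT b f a ≡ f t
ifT-yes true _ = refl

ifT-no : ∀ {A : Set} b → ¬ T b → ∀ {f : T b → A} {a} → ifT b f a ≡ a
ifT-no true  ¬t = ⊥-elim (¬t tt)
ifT-no false ¬t = refl

substP-coeffProd : ∀ {W} (f : V → Poly W) ls k → substP f (coeffProd ls k) ≡ coeffProd (map (substP f) ls) k
substP-coeffProd f []       zero    = refl
substP-coeffProd f []       (suc k) = refl
substP-coeffProd f (l ∷ ls) zero    = substP-coeffProd f ls zero
substP-coeffProd f (l ∷ ls) (suc k) =
  ≡.cong₂ (λ a b → a ⊕ (⊝ substP f l) ⊗ b) (substP-coeffProd f ls (suc k)) (substP-coeffProd f ls k)

substP-∑ : ∀ {W} (f : V → Poly W) (g : A → Poly V) xs → substP f (∑ xs g) ≡ ∑[ x ∈ xs ] substP f (g x)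
substP-∑ f g []       = refl
substP-∑ f g (x ∷ xs) = ≡.cong (substP f (g x) ⊕_) (substP-∑ f g xs)

module ChowFormula {n : ℕ} (M : Matroid n) (Ms : ℕ → Matroid n)
  (rank-Ms : ∀ i → i ≤ n → rank (Ms i) ≡ i)
  (Ms-top : ∀ S → rk (Ms (rank M)) S ≡ rk M S)
  (Ms-quotients : ∀ i j → i < j → j ≤ n → IsQuotient (Ms i) (Ms j))
  where

  r : ℕ
  r = rank M

  r≤n : r ≤ n
  r≤n = ≡.subst (r ≤_) (∣⊤∣≡n n) (rk-bound M Full)

  jump : ℕ → Subset n → ℕ
  jump i F = rk (Ms (suc i)) F ∸ rk (Ms i) F

  module _ {i : ℕ} (i<r : i < r) where

    private
      1+i≤n : suc i ≤ n
      1+i≤n = ℕ.≤-trans i<r r≤n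
      open Quotient (Ms i) (Ms (suc i)) (Ms-quotients i (suc i) (ℕ.n<1+n i) 1+i≤n) using (rk-gap-mono)

    rk-step-mono : ∀ S → rk (Ms i) S ≤ rk (Ms (suc i)) S
    rk-step-mono S = ≡.subst₂ _≤_ (drop-∅ (Ms (suc i)) (Ms i)) (drop-∅ (Ms i) (Ms (suc i))) (rk-gap-mono ⊥⊆)
      where
      drop-∅ : ∀ N N′ → rk N′ S + rk N ∅ ≡ rk N′ S
      drop-∅ N N′ = ≡.trans (≡.cong (λ z → rk N′ S + z) (MatroidRank.rk-∅ N)) (ℕ.+-identityʳ _)

    jump≤1 : ∀ F → jump i F ≤ 1
    jump≤1 F = begin
      rk (Ms (suc i)) F ∸ rk (Ms i) F       ≤⟨ ℕ.∸-monoˡ-≤ (rk (Ms i) F) (ℕ.+-cancelˡ-≤ i _ _ gap) ⟩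
      suc (rk (Ms i) F) ∸ rk (Ms i) F       ≡⟨ ℕ.m+n∸n≡m 1 (rk (Ms i) F) ⟩
      1                                     ∎
      where
      open ℕ.≤-Reasoning
      gap : i + rk (Ms (suc i)) F ≤ i + suc (rk (Ms i) F)
      gap = ≡.subst₂ (λ a b → a + rk (Ms (suc i)) F ≤ b) (rank-Ms i (ℕ.<⇒≤ 1+i≤n))
              (≡.trans (≡.cong (_+ rk (Ms i) F) (rank-Ms (suc i) 1+i≤n)) (≡.sym (ℕ.+-suc i _)))
              (rk-gap-mono ⊆⊤)

    jump-downward : ∀ {F F′} → F′ ⊆ F → jump i F ≡ 0 → jump i F′ ≡ 0
    jump-downward {F} {F′} F′⊆F no-jump = ℕ.m≤n⇒m∸n≡0 (ℕ.+-cancelˡ-≤ (rk (Ms i) F) _ _ (begin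
      rk (Ms i) F + rk (Ms (suc i)) F′   ≤⟨ rk-gap-mono F′⊆F ⟩
      rk (Ms (suc i)) F + rk (Ms i) F′   ≤⟨ ℕ.+-monoˡ-≤ (rk (Ms i) F′) (ℕ.m∸n≡0⇒m≤n no-jump) ⟩
      rk (Ms i) F + rk (Ms i) F′         ∎))
      where open ℕ.≤-Reasoning

  ∑jump≡rk : ∀ F m → m ≤ r → sum (map (λ i → jump i F) (upTo m)) ≡ rk (Ms m) F
  ∑jump≡rk F zero    _     =
    ≡.sym (ℕ.n≤0⇒n≡0 (≡.subst (rk (Ms 0) F ≤_) (rank-Ms 0 z≤n) (rk-mono (Ms 0) F Full ⊆⊤)))
  ∑jump≡rk F (suc m) 1+m≤r = begin
    sum (map jumps (upTo (suc m)))            ≡⟨ ≡.cong (sum ∘ map jumps) (≡.sym (List.upTo-∷ʳ m)) ⟩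
    sum (map jumps (upTo m ∷ʳ m))             ≡⟨ ≡.cong sum (List.map-++ jumps (upTo m) (m ∷ [])) ⟩
    sum (map jumps (upTo m) ++ jump m F ∷ []) ≡⟨ Sum.sum-++ (map jumps (upTo m)) (jump m F ∷ []) ⟩
    sum (map jumps (upTo m)) + (jump m F + 0) ≡⟨ ≡.cong₂ _+_ (∑jump≡rk F m (ℕ.<⇒≤ 1+m≤r)) (ℕ.+-identityʳ _) ⟩
    rk (Ms m) F + jump m F                    ≡⟨ ℕ.m+[n∸m]≡n (rk-step-mono 1+m≤r F) ⟩
    rk (Ms (suc m)) F                         ∎
    where
    open ≡.≡-Reasoning
    jumps = λ i → jump i F

  open QuotientRing (ChowRel M)
  open Sums (ChowRel M)
  open Symmetric (ChowRel M) public using (esym; sign)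
  open Symmetric (ChowRel M) using (esym-cong; coeffProd≈sign*esym; weight)
  open import Relation.Binary.Reasoning.Setoid setoid

  flats : List (Subset n)
  flats = nonemptyFlats M

  flats-good : All (IsNEFlat M) flats
  flats-good = Allₚ.all-filter (isNEFlat? M) (allSubsets n)

  flats-⊈ : AllPairs _⊈_ flats
  flats-⊈ = AllPairsₚ.filter⁺ (isNEFlat? M) (allSubsets-⊈ n)

  xM-flat : ∀ {F} (F-flat : IsNEFlat M F) → xM M F ≡ var (F , fromWitness F-flat)
  xM-flat {F} F-flat = ifT-yes ⌊ isNEFlat? M F ⌋ (fromWitness F-flat)

  xM-nonflat : ∀ {F} → ¬ IsNEFlat M F → xM M F ≡ 0#
  xM-nonflat {F} F-nonflat = ifT-no ⌊ isNEFlat? M F ⌋ (F-nonflat ∘ toWitness)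

  xM-incomparable : ∀ {F F′} → IsNEFlat M F → IsNEFlat M F′ → Incomparable F F′ → xM M F ⊗ xM M F′ ≈ 0#
  xM-incomparable F-flat F′-flat F∥F′ =
    trans′ (≡⇒≈ (≡.cong₂ _⊗_ (xM-flat F-flat) (xM-flat F′-flat))) (gen (incomp _ _ F∥F′))

  open ChainExpansion (ChowRel M) (IsNEFlat M) (rk M) (xM M) (upTo r) jump
    xM-incomparable proj₁
    (λ i∈ _ → jump≤1 (∈-upTo⁻ i∈) _)
    (λ {F} _ → ≡.trans (∑jump≡rk F r ℕ.≤-refl) (Ms-top F))
    (λ i∈ _ _ F′⊂F → jump-downward (∈-upTo⁻ i∈) (p⊂q⇒p⊆q F′⊂F))
    public using (ℓ; expansion)

  ι*-Lclass : ∀ {i} → i < r → ι* M (Lclass Ms i) ≈ ℓ flats i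
  ι*-Lclass {i} i<r = begin
    ι* M (Lclass Ms i)
      ≡⟨ substP-∑ _ (λ S → con (c S) ⊗ xU S) (nonemptySubsets n) ⟩
    ∑[ S ∈ nonemptySubsets n ] con (c S) ⊗ ι* M (xU S)
      ≈⟨ ∑-filter (dec⊂ ∅) _ (allSubsets n) ⟩
    ∑[ S ∈ allSubsets n ] guard (dec⊂ ∅ S) (con (c S) ⊗ ι* M (xU S))
      ≈⟨ ∑-cong (allSubsets n) (λ S → restrict (isNEFlat? M S) (dec⊂ ∅ S)) ⟩
    ∑[ S ∈ allSubsets n ] guard (isNEFlat? M S) (⌜ jump i S ⌝ ⊗ xM M S)
      ≈⟨ sym′ (∑-filter (isNEFlat? M) _ (allSubsets n)) ⟩
    ℓ flats i ∎
    where
    c : Subset n → ℤ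
    c S = + rk (Ms (suc i)) S ℤ.- + rk (Ms i) S
    c≡jump : ∀ S → c S ≡ + jump i S
    c≡jump S = ≡.trans (ℤ.[+m]-[+n]≡m⊖n (rk (Ms (suc i)) S) (rk (Ms i) S)) (ℤ.⊖-≥ (rk-step-mono i<r S))
    ι*-xU : ∀ {S} → ∅ ⊂ S → ι* M (xU S) ≡ xM M S
    ι*-xU {S} ∅⊂S = ≡.cong (ι* M) (ifT-yes ⌊ dec⊂ ∅ S ⌋ (fromWitness ∅⊂S))
    restrict : ∀ {S} (flat? : Dec (IsNEFlat M S)) (nonempty? : Dec (∅ ⊂ S)) →
               guard nonempty? (con (c S) ⊗ ι* M (xU S)) ≈ guard flat? (⌜ jump i S ⌝ ⊗ xM M S)
    restrict (yes _)         (yes ∅⊂S) = ≡⇒≈ (≡.cong₂ (λ a b → con a ⊗ b) (c≡jump _) (ι*-xU ∅⊂S))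
    restrict (yes S-flat)    (no ∅⊄S)  = ⊥-elim (∅⊄S (proj₁ S-flat))
    restrict (no S-nonflat)  (yes ∅⊂S) =
      *-≈0ʳ _ (≡⇒≈ (≡.trans (ι*-xU ∅⊂S) (xM-nonflat S-nonflat)))
    restrict (no _)          (no _)    = refl′

  ι*-cS : ∀ k → ι* M (cS Ms r k) ≈ con (sign k) ⊗ esym (map (ℓ flats) (upTo r)) k
  ι*-cS k = begin
    ι* M (cS Ms r k)
      ≡⟨ substP-coeffProd _ (map (Lclass Ms) (upTo r)) k ⟩
    coeffProd (map (ι* M) (map (Lclass Ms) (upTo r))) k
      ≈⟨ coeffProd≈sign*esym _ k ⟩
    con (sign k) ⊗ esym (map (ι* M) (map (Lclass Ms) (upTo r))) k
      ≡⟨ ≡.cong (λ ls → con (sign k) ⊗ esym ls k) (≡.sym (List.map-∘ (upTo r))) ⟩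
    con (sign k) ⊗ esym (map (ι* M ∘ Lclass Ms) (upTo r)) k
      ≈⟨ ⊗-cong refl′ (esym-cong (upTo r) (All.tabulate (ι*-Lclass ∘ ∈-upTo⁻)) k) ⟩
    con (sign k) ⊗ esym (map (ℓ flats) (upTo r)) k ∎

  ∑-chainsAbove-suc : ∀ t A (f : List (Subset n) → Poly (VarM M)) →
                      ∑ (chainsAbove M (suc t) A) f ≈
                      ∑[ F ∈ filter (dec⊂ A) flats ] ∑[ Fs ∈ chainsAbove M t F ] f (F ∷ Fs)
  ∑-chainsAbove-suc t A f =
    trans′ (∑-concatMap f _ (filter (dec⊂ A) flats))
           (∑-cong (filter (dec⊂ A) flats) (λ F → ≡⇒≈ (∑-map f (F ∷_) (chainsAbove M t F))))

  ∑-compositions-suc : ∀ t k′ (f : List ℕ → Poly (VarM M)) →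
                       ∑ (compositions (suc t) k′) f ≈
                       ∑[ p < k′ ] ∑[ ps ∈ compositions t (k′ ∸ suc p) ] f (suc p ∷ ps)
  ∑-compositions-suc t k′ f =
    trans′ (∑-concatMap f _ (applyUpTo suc k′))
           (trans′ (∑-cong (applyUpTo suc k′) (λ p → ≡⇒≈ (∑-map f (p ∷_) (compositions t (k′ ∸ p)))))
                   (∑-applyUpTo _ suc k′))

  term : List (Subset n) → List ℕ → ℕ → Poly (VarM M)
  term Fs ps q = ⌜ binProd M Fs ps q ⌝ ⊗ monomial M Fs ps

  term-∷ : ∀ F Fs p ps q → term (F ∷ Fs) (p ∷ ps) q ≈ weight (xM M F) (rk M F) q p ⊗ term Fs ps (q + p)
  term-∷ F Fs p ps q = begin
    ⌜ a * b ⌝ ⊗ (xᵖ ⊗ m)            ≡⟨ ≡.cong (λ z → con z ⊗ (xᵖ ⊗ m)) (ℤ.pos-* a b) ⟩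
    con (+ a ℤ.* + b) ⊗ (xᵖ ⊗ m)    ≈⟨ ⊗-cong (sym′ (con-* _ _)) refl′ ⟩
    (⌜ a ⌝ ⊗ ⌜ b ⌝) ⊗ (xᵖ ⊗ m)      ≈⟨ solve 4 (λ a b x m → (a :* b) :* (x :* m) := (a :* x) :* (b :* m))
                                               refl′ ⌜ a ⌝ ⌜ b ⌝ xᵖ m ⟩
    (⌜ a ⌝ ⊗ xᵖ) ⊗ (⌜ b ⌝ ⊗ m)      ∎
    where
    a  = (rk M F ∸ q) C p
    b  = binProd M Fs ps (q + p)
    xᵖ = xM M F ^^ p
    m  = monomial M Fs ps

  chainTerms : ℕ → Subset n → ℕ → ℕ → Poly (VarM M)
  chainTerms t A q k′ = ∑[ Fs ∈ chainsAbove M t A ] ∑[ ps ∈ compositions t k′ ] term Fs ps q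

  chainTerms-suc : ∀ t A q k′ →
                   chainTerms (suc t) A q k′ ≈
                   ∑[ F ∈ filter (dec⊂ A) flats ] ∑[ p < k′ ]
                     weight (xM M F) (rk M F) q (suc p) ⊗ chainTerms t F (q + suc p) (k′ ∸ suc p)
  chainTerms-suc t A q k′ = trans′ (∑-chainsAbove-suc t A _) (∑-cong (filter (dec⊂ A) flats) λ F → begin
    ∑[ Fs ∈ chainsAbove M t F ] ∑[ ps ∈ compositions (suc t) k′ ] term (F ∷ Fs) ps q
      ≈⟨ ∑-cong (chainsAbove M t F) (λ Fs → trans′ (∑-compositions-suc t k′ _) (∑<-cong k′ (λ p _ → pull F Fs p))) ⟩
    ∑[ Fs ∈ chainsAbove M t F ] ∑[ p < k′ ] w F p ⊗ rest Fs p
      ≈⟨ sym′ (∑<-∑-swap _ k′ (chainsAbove M t F)) ⟩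
    ∑[ p < k′ ] ∑[ Fs ∈ chainsAbove M t F ] w F p ⊗ rest Fs p
      ≈⟨ ∑<-cong k′ (λ p _ → sym′ (*-∑ (w F p) _ (chainsAbove M t F))) ⟩
    ∑[ p < k′ ] w F p ⊗ chainTerms t F (q + suc p) (k′ ∸ suc p) ∎)
    where
    w : Subset n → ℕ → Poly (VarM M)
    w F p = weight (xM M F) (rk M F) q (suc p)
    rest : List (Subset n) → ℕ → Poly (VarM M)
    rest Fs p = ∑[ ps ∈ compositions t (k′ ∸ suc p) ] term Fs ps (q + suc p)
    pull : ∀ F Fs p → ∑[ ps ∈ compositions t (k′ ∸ suc p) ] term (F ∷ Fs) (suc p ∷ ps) q ≈ w F p ⊗ rest Fs p
    pull F Fs p = trans′ (∑-cong (compositions t (k′ ∸ suc p)) (λ ps → term-∷ F Fs (suc p) ps q))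
                         (sym′ (*-∑ (w F p) (λ ps → term Fs ps (q + suc p)) (compositions t (k′ ∸ suc p))))

  module Degree (k : ℕ) where

    open Chains (ChowRel M) (rk M) (xM M) k public using (chainSum; at)
    open Chains (ChowRel M) (rk M) (xM M) k using (chainSum-vanish)

    chainTerms≈chainSum : ∀ t A q k′ → k′ ≤ k → chainTerms t A q k′ ≈ chainSum (at (q + k′)) flats t A q
    chainTerms≈chainSum zero    A q zero     _ =
      trans′ (+-identityʳ _) (trans′ (+-identityʳ _) (trans′ (⊗-idˡ _)
        (sym′ (guard-yes (≡.sym (ℕ.+-identityʳ q)) (q ℕ.≟ q + 0) _))))
    chainTerms≈chainSum zero    A q (suc k′) _ =
      trans′ (⊕-idˡ _) (sym′ (guard-no (λ q≡q+1+k′ → ℕ.<-irrefl q≡q+1+k′ (ℕ.m<m+n q (s≤s z≤n)))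
                                       (q ℕ.≟ q + suc k′) _))
    chainTerms≈chainSum (suc t) A q k′ k′≤k =
      trans′ (chainTerms-suc t A q k′) (∑-cong (filter (dec⊂ A) flats) λ F →
        trans′ (∑<-cong k′ (λ p p<k′ → ⊗-cong refl′ (lower F p p<k′)))
               (sym′ (∑<-truncate _ k′ k k′≤k (λ p k′≤p _ → *-≈0ʳ _ (beyond F p k′≤p)))))
      where
      lower : ∀ F p → p < k′ →
              chainTerms t F (q + suc p) (k′ ∸ suc p) ≈ chainSum (at (q + k′)) flats t F (q + suc p)
      lower F p p<k′ =
        trans′ (chainTerms≈chainSum t F (q + suc p) (k′ ∸ suc p) (ℕ.≤-trans (ℕ.m∸n≤m k′ (suc p)) k′≤k))
               (≡⇒≈ (≡.cong (λ j → chainSum (at j) flats t F (q + suc p)) degree))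
        where
        degree : q + suc p + (k′ ∸ suc p) ≡ q + k′
        degree = ≡.trans (ℕ.+-assoc q (suc p) (k′ ∸ suc p)) (≡.cong (λ m → q + m) (ℕ.m+[n∸m]≡n p<k′))
      beyond : ∀ F p → k′ ≤ p → chainSum (at (q + k′)) flats t F (q + suc p) ≈ 0#
      beyond F p k′≤p = chainSum-vanish (at (q + k′)) (suc (q + k′)) at-vanish flats t F (q + suc p)
                                        (ℕ.≤-trans q+k′<q+1+p (ℕ.m≤m+n (q + suc p) t))
        where
        q+k′<q+1+p : q + k′ < q + suc p
        q+k′<q+1+p = ℕ.+-monoʳ-< q (s≤s k′≤p)
        at-vanish : ∀ q′ → q + k′ < q′ → at (q + k′) q′ ≈ 0#
        at-vanish q′ q+k′<q′ = guard-no (ℕ.<⇒≢ q+k′<q′ ∘ ≡.sym) (q′ ℕ.≟ q + k′) _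

    chFormula≈chainSums : chFormula M k ≈ con (sign k) ⊗ (∑[ t < suc k ] chainSum (at k) flats t ∅ 0)
    chFormula≈chainSums = begin
      chFormula M k
        ≈⟨ Σ⊕-concatMap (λ t → concatMap (terms t) (chainsAbove M t ∅)) (upTo (suc k)) ⟩
      ∑[ t ∈ upTo (suc k) ] Σ⊕ (concatMap (terms t) (chainsAbove M t ∅))
        ≈⟨ ∑-cong (upTo (suc k)) (λ t → Σ⊕-concatMap (terms t) (chainsAbove M t ∅)) ⟩
      ∑[ t ∈ upTo (suc k) ] ∑[ Fs ∈ chainsAbove M t ∅ ] ∑[ ps ∈ compositions t k ] α Fs ps
        ≈⟨ ∑-cong (upTo (suc k)) (λ t → trans′ (∑-cong (chainsAbove M t ∅) (λ Fs → sign-out t Fs))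
                                                (sym′ (*-∑ _ _ (chainsAbove M t ∅)))) ⟩
      ∑[ t ∈ upTo (suc k) ] con (sign k) ⊗ chainTerms t ∅ 0 k
        ≈⟨ trans′ (sym′ (*-∑ _ _ (upTo (suc k)))) (⊗-cong refl′ (∑-applyUpTo _ id (suc k))) ⟩
      con (sign k) ⊗ (∑[ t < suc k ] chainTerms t ∅ 0 k)
        ≈⟨ ⊗-cong refl′ (∑<-cong (suc k) (λ t _ → chainTerms≈chainSum t ∅ 0 k ℕ.≤-refl)) ⟩
      con (sign k) ⊗ (∑[ t < suc k ] chainSum (at k) flats t ∅ 0) ∎
      where
      α : List (Subset n) → List ℕ → Poly (VarM M)
      α Fs ps = con (alphaS M k Fs ps) ⊗ monomial M Fs ps
      terms : ℕ → List (Subset n) → List (Poly (VarM M))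
      terms t Fs = map (α Fs) (compositions t k)
      sign-out : ∀ t Fs → ∑[ ps ∈ compositions t k ] α Fs ps ≈
                          con (sign k) ⊗ (∑[ ps ∈ compositions t k ] term Fs ps 0)
      sign-out t Fs =
        trans′ (∑-cong (compositions t k) (λ ps → trans′ (⊗-cong (sym′ (con-* _ _)) refl′) (⊗-assoc _ _ _)))
               (sym′ (*-∑ _ _ (compositions t k)))

-- The identity holds in every degree k.
corollary3p2 : ∀ {n} (M : Matroid n) (Ms : ℕ → Matroid n) →
    (∀ i → i ≤ n → rank (Ms i) ≡ i) →
    (∀ S → rk (Ms (rank M)) S ≡ rk M S) →
    (∀ i j → i < j → j ≤ n → IsQuotient (Ms i) (Ms j)) →
    ∀ k → k ≤ rank M →
    EqA M (ι* M (cS Ms (rank M) k)) (chFormula M k)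
corollary3p2 M Ms rank-Ms Ms-top Ms-quotients k _ = begin
  ι* M (cS Ms (rank M) k)
    ≈⟨ ι*-cS k ⟩
  con (sign k) ⊗ esym (map (ℓ flats) (upTo (rank M))) k
    ≈⟨ ⊗-cong refl′ (expansion k flats flats-good flats-⊈ k ℕ.≤-refl) ⟩
  con (sign k) ⊗ (∑[ t < suc k ] chainSum (at k) flats t ∅ 0)
    ≈⟨ sym′ chFormula≈chainSums ⟩
  chFormula M k ∎
  where
  open ChowFormula M Ms rank-Ms Ms-top Ms-quotients
  open Degree k
  open QuotientRing (ChowRel M) using (setoid)
  open import Relation.Binary.Reasoning.Setoid setoid
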